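{- Let $q$ be an odd prime power with $q\equiv 1\pmod 4$, and let $A$ be an integer with $q+1-A\equiv 0\pmod 8$. Then there exists a bijection between the sets $N_{2n4}(A)$ and $N_{n2}(A)$.
   Context: For $d\in\mathbb{F}_q\setminus\{0,1\}$, let $L_d$ be the Legendre curve $y^2=x(x-1)(x-d)$ over $\mathbb{F}_q$ and $A(d,\mathbb{F}_q)=q+1-\#L_d(\mathbb{F}_q)$. For an integer $A$, $N_{2n4}(A)$ denotes the set of $d\in\mathbb{F}_q\setminus\{0,1\}$ with $A(d,\mathbb{F}_q)=A$ that are squares but not fourth powers in $\mathbb{F}_q$, and $N_{n2}(A)$ the set of $d\in\mathbb{F}_q\setminus\{0,1\}$ with $A(d,\mathbb{F}_q)=A$ that are non-squares in $\mathbb{F}_q$. -}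

module Defs where

open import Data.Nat using (ℕ; zero; suc)
open import Data.Fin using (Fin)
open import Data.Integer using (ℤ; +_; _-_)
open import Data.Product using (Σ; ∃; _×_; _,_)
open import Relation.Nullary using (¬_; Dec; yes; no)
open import Relation.Binary.PropositionalEquality using (_≡_; _≢_)
open import Relation.Binary using (DecidableEquality)
open import Algebra.Structures using (IsCommutativeRing)
open import Function.Bundles using (_↔_; Inverse)

record FiniteField (q : ℕ) : Set₁ where
  infixl 7 _*_
  infixl 6 _+_
  field
    Carrier : Set
    _+_ : Carrier → Carrier → Carrier
    _*_ : Carrier → Carrier → Carrier
    -_  : Carrier → Carrier
    0# : Carrier
    1# : Carrier
    isCommutativeRing : IsCommutativeRing _≡_ _+_ _*_ -_ 0# 1#
    0≢1 : 0# ≢ 1#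
    inverse : ∀ x → x ≢ 0# → ∃ λ y → x * y ≡ 1#
    _≟_ : DecidableEquality Carrier
    enumeration : Fin q ↔ Carrier

  _-ᶠ_ : Carrier → Carrier → Carrier
  x -ᶠ y = x + (- y)

  enum : Fin q → Carrier
  enum = Inverse.to enumeration

sumFin : (n : ℕ) → (Fin n → ℕ) → ℕ
sumFin zero f = 0
sumFin (suc n) f = f Fin.zero Data.Nat.+ sumFin n (λ i → f (Fin.suc i))

indicator : ∀ {P : Set} → Dec P → ℕ
indicator (yes _) = 1
indicator (no _) = 0

module _ {q : ℕ} (F : FiniteField q) where
  open FiniteField F

  affineCount : Carrier → ℕ
  affineCount d = sumFin q λ i → sumFin q λ j →
    indicator ((enum j * enum j) ≟ (enum i * (enum i -ᶠ 1#) * (enum i -ᶠ d)))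

  -- #L_d(F_q): affine points plus the point at infinity
  pointCount : Carrier → ℕ
  pointCount d = suc (affineCount d)

  traceA : Carrier → ℤ
  traceA d = (+ q Data.Integer.+ + 1) - + pointCount d

  IsSquare : Carrier → Set
  IsSquare d = ∃ λ y → d ≡ y * y

  IsFourthPower : Carrier → Set
  IsFourthPower d = ∃ λ y → d ≡ (y * y) * (y * y)

  InN2n4 : ℤ → Carrier → Set
  InN2n4 A d = d ≢ 0# × d ≢ 1# × traceA d ≡ A × IsSquare d × ¬ IsFourthPower d

  InNn2 : ℤ → Carrier → Set
  InNn2 A d = d ≢ 0# × d ≢ 1# × traceA d ≡ A × ¬ IsSquare d

  SubsetBijection : (Carrier → Set) → (Carrier → Set) → Set
  SubsetBijection P Q = Σ (Carrier → Carrier) λ f →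
      (∀ d → P d → Q (f d))
    × (∀ d e → P d → P e → f d ≡ f e → d ≡ e)
    × (∀ e → Q e → ∃ λ d → P d × f d ≡ e)

module Submission where

-- Traces are character sums: with χ the quadratic character of F,
--     A(d) = −T d,   where  T d = Σₓ χ(x(x − 1)(x − d)).
-- Two transformations preserve T: the reflection d ↦ 1 − d and Landen's
-- transformation T(u²) = T(v²), v = (1 − u)/(1 + u).  Composing them gives
--     d = u²  ↦  E u = 1 − v² = 4u/(1 + u)²,
-- which sends squares with non-square roots (N_{2n4}) to non-squares (N_{n2})
-- of the same trace.  Since E u = E (1/u), it is injective once the root u of
-- d is chosen coherently for d and 1/d.  For surjectivity, 1 − e must be a
-- square for e ∈ N_{n2}(A): otherwise a free action of a Klein four-group
-- gives #L_e ≡ 4 (mod 8), contradicting 8 ∣ q + 1 − A.  The hypothesis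
-- q ≡ 1 (mod 4) is used through 2 ≠ 0 and "−1 is a square", both again proved
-- by counting orbits.

open import Defs
open import Data.Nat as ℕ using (ℕ; zero; suc; _%_; _/_; _<ᵇ_)
import Data.Nat.Properties as ℕP
import Data.Nat.DivMod as ℕDivMod
import Data.Nat.Divisibility as ℕD
open import Data.Integer as ℤ using (ℤ; +_; -[1+_]; _⊖_; _◃_; 0ℤ; 1ℤ; -1ℤ)
import Data.Integer.Properties as ℤP
open import Data.Integer.Divisibility as ℤD using ()
open import Data.Integer.Tactic.RingSolver using (solve-∀)
open import Data.Sign as Sign using (Sign)
open import Data.Fin as Fin using (Fin; toℕ)
import Data.Fin.Properties as FinP
open import Data.Fin.Permutation using (Permutation; permutation)
open import Data.Bool using (Bool; true; false; _∧_)
open import Data.Maybe using (Maybe; just; nothing)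
open import Data.Product using (∃; _×_; _,_; proj₁; proj₂)
open import Data.Sum using (_⊎_; inj₁; inj₂; [_,_]′)
open import Data.Empty using (⊥; ⊥-elim)
open import Relation.Nullary using (¬_; Dec; yes; no; does)
open import Relation.Nullary.Decidable using (¬?; _×-dec_; dec-true; dec-false; toSum)
open import Relation.Binary.PropositionalEquality
open import Function.Bundles using (Inverse)
open import Algebra.Bundles using (CommutativeRing)
import Algebra.Solver.Ring.AlmostCommutativeRing as ACR
import Algebra.Solver.Ring as RingSolver
import Algebra.Properties.Ring as RingProperties
import Algebra.Properties.Monoid.Mult.TCOptimised as MonoidMult
import Algebra.Properties.Semiring.Mult.TCOptimised as SemiringMult
import Algebra.Properties.Semiring.Sum as SemiringSum

-- Ring normalisation in a finite field, with integer coefficients.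
-- The solver needs a homomorphism from a ring whose equality is decidable
-- by computation; we use ℤ → F, n ↦ n · 1.
module FieldSolver {q : ℕ} (F : FiniteField q) where
  open FiniteField F

  commutativeRing : CommutativeRing _ _
  commutativeRing = record { isCommutativeRing = isCommutativeRing }

  open CommutativeRing commutativeRing public
    using (+-assoc; +-comm; *-assoc; *-comm; +-identityˡ; +-identityʳ; *-identityˡ; *-identityʳ;
           zeroˡ; zeroʳ; -‿inverseˡ; -‿inverseʳ; ring; +-monoid; semiring)
  open RingProperties ring public
    using (-‿involutive; -‿injective; -‿distribʳ-*; -‿+-comm; -1*x≈-x; +-cancelˡ)
  open MonoidMult +-monoid using (×-homo-+; 1+×) renaming (_×_ to _·_)
  open SemiringMult semiring using (×1-homo-*)

  ⟦_⟧ℤ : ℤ → Carrier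
  ⟦ + n ⟧ℤ = n · 1#
  ⟦ -[1+ n ] ⟧ℤ = - (suc n · 1#)

  -0≡0 : - 0# ≡ 0#
  -0≡0 = trans (sym (+-identityˡ (- 0#))) (-‿inverseʳ 0#)

  private
    ⊖-homo : ∀ m n → ⟦ m ⊖ n ⟧ℤ ≡ m · 1# + - (n · 1#)
    ⊖-homo zero zero = sym (-‿inverseʳ 0#)
    ⊖-homo zero (suc n) = sym (+-identityˡ _)
    ⊖-homo (suc m) zero = sym (trans (cong (λ z → suc m · 1# + z) -0≡0) (+-identityʳ _))
    ⊖-homo (suc m) (suc n) rewrite ℤP.[1+m]⊖[1+n]≡m⊖n m n | ⊖-homo m n = begin
      m · 1# + - (n · 1#)                 ≡⟨ cong (λ z → m · 1# + z) (sym (+-identityˡ _)) ⟩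
      m · 1# + (0# + - (n · 1#))           ≡⟨ cong (λ z → m · 1# + (z + - (n · 1#))) (sym (-‿inverseʳ 1#)) ⟩
      m · 1# + ((1# + - 1#) + - (n · 1#))   ≡⟨ cong (λ z → m · 1# + z) (+-assoc 1# (- 1#) _) ⟩
      m · 1# + (1# + (- 1# + - (n · 1#)))   ≡⟨ sym (+-assoc (m · 1#) 1# _) ⟩
      (m · 1# + 1#) + (- 1# + - (n · 1#))   ≡⟨ cong₂ _+_ (+-comm (m · 1#) 1#) (-‿+-comm 1# (n · 1#)) ⟩
      (1# + m · 1#) + - (1# + n · 1#)       ≡⟨ sym (cong₂ (λ a b → a + - b) (1+× m 1#) (1+× n 1#)) ⟩
      suc m · 1# + - (suc n · 1#)           ∎
      where open ≡-Reasoning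

    sign : Sign → Carrier
    sign Sign.+ = 1#
    sign Sign.- = - 1#

    sign-homo : ∀ s t → sign (s Sign.* t) ≡ sign s * sign t
    sign-homo Sign.+ t = sym (*-identityˡ _)
    sign-homo Sign.- Sign.+ = sym (*-identityʳ _)
    sign-homo Sign.- Sign.- = sym (trans (-1*x≈-x (- 1#)) (-‿involutive 1#))

    ◃-homo : ∀ s n → ⟦ s ◃ n ⟧ℤ ≡ sign s * (n · 1#)
    ◃-homo s zero = sym (zeroʳ _)
    ◃-homo Sign.+ (suc n) = sym (*-identityˡ _)
    ◃-homo Sign.- (suc n) = sym (-1*x≈-x _)

    sign-abs : ∀ i → ⟦ i ⟧ℤ ≡ sign (ℤ.sign i) * (ℤ.∣ i ∣ · 1#)
    sign-abs (+ n) = sym (*-identityˡ _)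
    sign-abs -[1+ n ] = sym (-1*x≈-x _)

    +-homo : ∀ i j → ⟦ i ℤ.+ j ⟧ℤ ≡ ⟦ i ⟧ℤ + ⟦ j ⟧ℤ
    +-homo (+ m) (+ n) = ×-homo-+ 1# m n
    +-homo (+ m) -[1+ n ] = ⊖-homo m (suc n)
    +-homo -[1+ m ] (+ n) = trans (⊖-homo n (suc m)) (+-comm _ _)
    +-homo -[1+ m ] -[1+ n ] = sym (trans (-‿+-comm (suc m · 1#) (suc n · 1#))
       (cong -_ (trans (sym (×-homo-+ 1# (suc m) (suc n))) (cong (λ k → suc k · 1#) (ℕP.+-suc m n)))))

    *-homo : ∀ i j → ⟦ i ℤ.* j ⟧ℤ ≡ ⟦ i ⟧ℤ * ⟦ j ⟧ℤ
    *-homo i j = begin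
      ⟦ i ℤ.* j ⟧ℤ                      ≡⟨ ◃-homo (ℤ.sign i Sign.* ℤ.sign j) (ℤ.∣ i ∣ ℕ.* ℤ.∣ j ∣) ⟩
      sign (si Sign.* sj) * ((a ℕ.* b) · 1#) ≡⟨ cong₂ _*_ (sign-homo si sj) (×1-homo-* a b) ⟩
      (sign si * sign sj) * (a · 1# * b · 1#) ≡⟨ interchange (sign si) (sign sj) (a · 1#) (b · 1#) ⟩
      (sign si * a · 1#) * (sign sj * b · 1#) ≡⟨ sym (cong₂ _*_ (sign-abs i) (sign-abs j)) ⟩
      ⟦ i ⟧ℤ * ⟦ j ⟧ℤ                   ∎
      where
      open ≡-Reasoning
      si sj : Sign
      si = ℤ.sign i
      sj = ℤ.sign j
      a b : ℕ
      a = ℤ.∣ i ∣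
      b = ℤ.∣ j ∣
      interchange : ∀ w x y z → (w * x) * (y * z) ≡ (w * y) * (x * z)
      interchange w x y z = begin
        (w * x) * (y * z) ≡⟨ *-assoc w x (y * z) ⟩
        w * (x * (y * z)) ≡⟨ cong (w *_) (sym (*-assoc x y z)) ⟩
        w * ((x * y) * z) ≡⟨ cong (λ t → w * (t * z)) (*-comm x y) ⟩
        w * ((y * x) * z) ≡⟨ cong (w *_) (*-assoc y x z) ⟩
        w * (y * (x * z)) ≡⟨ sym (*-assoc w y (x * z)) ⟩
        (w * y) * (x * z) ∎

    neg-homo : ∀ i → ⟦ ℤ.- i ⟧ℤ ≡ - ⟦ i ⟧ℤ
    neg-homo -[1+ n ] = sym (-‿involutive _)
    neg-homo (+ zero) = sym -0≡0
    neg-homo (+ suc n) = refl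

    almostCommutativeRing : ACR.AlmostCommutativeRing _ _
    almostCommutativeRing = ACR.fromCommutativeRing commutativeRing

    ℤ⟶F : ℤ.+-*-rawRing ACR.-Raw-AlmostCommutative⟶ almostCommutativeRing
    ℤ⟶F = record { ⟦_⟧ = ⟦_⟧ℤ ; +-homo = +-homo ; *-homo = *-homo ; -‿homo = neg-homo
                 ; 0-homo = refl ; 1-homo = refl }

    equal? : ∀ i j → Maybe (⟦ i ⟧ℤ ≡ ⟦ j ⟧ℤ)
    equal? i j with i ℤ.≟ j
    ... | yes i≡j = just (cong ⟦_⟧ℤ i≡j)
    ... | no _ = nothing

  open RingSolver ℤ.+-*-rawRing almostCommutativeRing ℤ⟶F equal? public
    using (solve; _:=_; _:+_; _:*_; _:-_; :-_; con)

-- Elementary arithmetic of a finite field: a total inverse (with inv 0 = 0),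
-- absence of zero divisors and its consequences.
module FieldArithmetic {q : ℕ} (F : FiniteField q) where
  open FiniteField F
  open FieldSolver F public

  infixl 6 _−_
  _−_ : Carrier → Carrier → Carrier
  a − b = a + - b

  two : Carrier
  two = 1# + 1#

  1≢0 : 1# ≢ 0#
  1≢0 e = 0≢1 (sym e)

  inv : Carrier → Carrier
  inv x with x ≟ 0#
  ... | yes _ = 0#
  ... | no x≢0 = proj₁ (inverse x x≢0)

  *-inverseʳ : ∀ {x} → x ≢ 0# → x * inv x ≡ 1#
  *-inverseʳ {x} x≢0 with x ≟ 0#
  ... | yes x≡0 = ⊥-elim (x≢0 x≡0)
  ... | no x≢0′ = proj₂ (inverse x x≢0′)

  *-inverseˡ : ∀ {x} → x ≢ 0# → inv x * x ≡ 1#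
  *-inverseˡ {x} x≢0 = trans (*-comm (inv x) x) (*-inverseʳ x≢0)

  -- a case split that, unlike  with x ≟ 0#,  does not unfold  inv  in the goal
  zero-or-nonzero : ∀ x → x ≡ 0# ⊎ x ≢ 0#
  zero-or-nonzero x = toSum (x ≟ 0#)

  inv-0 : inv 0# ≡ 0#
  inv-0 with 0# ≟ 0#
  ... | yes _ = refl
  ... | no 0≢0 = ⊥-elim (0≢0 refl)

  -- An identity that holds modulo the relation  y · j = 1:  it suffices that
  -- lhs − rhs is a polynomial multiple of  y · j − 1  (checked by the solver).
  by-inverse : ∀ {lhs rhs y j} r → y * j ≡ 1# → lhs ≡ rhs + (y * j − 1#) * r → lhs ≡ rhs
  by-inverse {lhs} {rhs} r yj≡1 e = begin
    lhs                         ≡⟨ e ⟩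
    rhs + (_ − 1#) * r          ≡⟨ cong (λ z → rhs + (z − 1#) * r) yj≡1 ⟩
    rhs + (1# − 1#) * r         ≡⟨ cong (λ z → rhs + z * r) (-‿inverseʳ 1#) ⟩
    rhs + 0# * r                ≡⟨ cong (λ z → rhs + z) (zeroˡ r) ⟩
    rhs + 0#                    ≡⟨ +-identityʳ rhs ⟩
    rhs                         ∎
    where open ≡-Reasoning

  no-zero-divisors : ∀ {x y} → x * y ≡ 0# → x ≡ 0# ⊎ y ≡ 0#
  no-zero-divisors {x} {y} xy≡0 with zero-or-nonzero x
  ... | inj₁ x≡0 = inj₁ x≡0
  ... | inj₂ x≢0 = inj₂ (by-inverse {y = inv x} {j = x} (- y) (*-inverseˡ x≢0) (begin
      y                             ≡⟨ solve 3 (λ x y i → y := i :* (x :* y) :+ (i :* x :- con (+ 1)) :* (:- y)) refl x y (inv x) ⟩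
      inv x * (x * y) + _           ≡⟨ cong (λ z → inv x * z + (inv x * x − 1#) * - y) xy≡0 ⟩
      inv x * 0# + _                ≡⟨ cong (λ z → z + (inv x * x − 1#) * - y) (zeroʳ (inv x)) ⟩
      0# + (inv x * x − 1#) * - y   ∎))
    where open ≡-Reasoning

  *-nonzero : ∀ {x y} → x ≢ 0# → y ≢ 0# → x * y ≢ 0#
  *-nonzero x≢0 y≢0 xy≡0 with no-zero-divisors xy≡0
  ... | inj₁ x≡0 = x≢0 x≡0
  ... | inj₂ y≡0 = y≢0 y≡0

  square-zero : ∀ {y} → y * y ≡ 0# → y ≡ 0#
  square-zero yy≡0 with no-zero-divisors yy≡0
  ... | inj₁ y≡0 = y≡0
  ... | inj₂ y≡0 = y≡0

  inv-nonzero : ∀ {x} → x ≢ 0# → inv x ≢ 0#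
  inv-nonzero {x} x≢0 i≡0 = 1≢0 (trans (sym (*-inverseʳ x≢0)) (trans (cong (x *_) i≡0) (zeroʳ x)))

  difference-zero : ∀ {a b} → a − b ≡ 0# → a ≡ b
  difference-zero {a} {b} e = begin
    a             ≡⟨ solve 2 (λ a b → a := (a :- b) :+ b) refl a b ⟩
    (a − b) + b   ≡⟨ cong (_+ b) e ⟩
    0# + b        ≡⟨ +-identityˡ b ⟩
    b             ∎
    where open ≡-Reasoning

  difference-nonzero : ∀ {a b} → a ≢ b → a − b ≢ 0#
  difference-nonzero a≢b e = a≢b (difference-zero e)

  *-cancelˡ : ∀ {x a b} → x ≢ 0# → x * a ≡ x * b → a ≡ b
  *-cancelˡ {x} {a} {b} x≢0 e with no-zero-divisors {x} {a − b} x[a−b]≡0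
    where
    x[a−b]≡0 : x * (a − b) ≡ 0#
    x[a−b]≡0 = trans (solve 3 (λ x a b → x :* (a :- b) := x :* a :- x :* b) refl x a b)
                     (trans (cong (_− x * b) e) (-‿inverseʳ (x * b)))
  ... | inj₁ x≡0 = ⊥-elim (x≢0 x≡0)
  ... | inj₂ a−b≡0 = difference-zero a−b≡0

  square-roots : ∀ {y w} → y * y ≡ w * w → y ≡ w ⊎ y ≡ - w
  square-roots {y} {w} e with no-zero-divisors {y − w} {y + w} product≡0
    where
    product≡0 : (y − w) * (y + w) ≡ 0#
    product≡0 = trans (solve 2 (λ y w → (y :- w) :* (y :+ w) := y :* y :- w :* w) refl y w)
                      (trans (cong (_− w * w) e) (-‿inverseʳ (w * w)))
  ... | inj₁ y−w≡0 = inj₁ (difference-zero y−w≡0)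
  ... | inj₂ y+w≡0 = inj₂ (difference-zero (trans (cong (λ z → y + z) (-‿involutive w)) y+w≡0))

  square-one : ∀ {x} → x * x ≡ 1# → x ≡ 1# ⊎ x ≡ - 1#
  square-one {x} e = square-roots (trans e (sym (*-identityˡ 1#)))

  neg-square : ∀ x → (- x) * (- x) ≡ x * x
  neg-square = solve 1 (λ x → (:- x) :* (:- x) := x :* x) refl

  inv-unique : ∀ {x y} → x * y ≡ 1# → y ≡ inv x
  inv-unique {x} {y} e = *-cancelˡ x≢0 (trans e (sym (*-inverseʳ x≢0)))
    where
    x≢0 : x ≢ 0#
    x≢0 x≡0 = 1≢0 (trans (sym e) (trans (cong (_* y) x≡0) (zeroˡ y)))

  inv-involutive : ∀ x → inv (inv x) ≡ x
  inv-involutive x with zero-or-nonzero x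
  ... | inj₁ refl = trans (cong inv inv-0) inv-0
  ... | inj₂ x≢0 = sym (inv-unique (*-inverseˡ x≢0))

  inv-* : ∀ x y → inv (x * y) ≡ inv x * inv y
  inv-* x y with zero-or-nonzero x | zero-or-nonzero y
  ... | inj₁ refl | _ = trans (cong inv (zeroˡ y)) (trans inv-0 (sym (trans (cong (_* inv y) inv-0) (zeroˡ _))))
  ... | inj₂ _ | inj₁ refl = trans (cong inv (zeroʳ x)) (trans inv-0 (sym (trans (cong (inv x *_) inv-0) (zeroʳ _))))
  ... | inj₂ x≢0 | inj₂ y≢0 = sym (inv-unique (begin
      (x * y) * (inv x * inv y) ≡⟨ solve 4 (λ x y a b → (x :* y) :* (a :* b) := (x :* a) :* (y :* b)) refl x y (inv x) (inv y) ⟩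
      (x * inv x) * (y * inv y) ≡⟨ cong₂ _*_ (*-inverseʳ x≢0) (*-inverseʳ y≢0) ⟩
      1# * 1#                   ≡⟨ *-identityˡ 1# ⟩
      1#                        ∎))
    where open ≡-Reasoning

  inv-neg : ∀ x → inv (- x) ≡ - inv x
  inv-neg x with zero-or-nonzero x
  ... | inj₁ refl = trans (cong inv -0≡0) (trans inv-0 (sym (trans (cong -_ inv-0) -0≡0)))
  ... | inj₂ x≢0 = sym (inv-unique (trans (solve 2 (λ x i → (:- x) :* (:- i) := x :* i) refl x (inv x)) (*-inverseʳ x≢0)))

  inv-1 : inv 1# ≡ 1#
  inv-1 = sym (inv-unique (*-identityˡ 1#))

  *-by-one : ∀ a {y j} → y * j ≡ 1# → a ≡ a * (y * j)
  *-by-one a yj≡1 = sym (trans (cong (a *_) yj≡1) (*-identityʳ a))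

  fraction-shift : ∀ {y} a b → y ≢ 0# → a * inv y − b ≡ (a − b * y) * inv y
  fraction-shift {y} a b y≢0 = begin
    a * inv y − b                  ≡⟨ cong (λ z → a * inv y − z) (sym (*-identityʳ b)) ⟩
    a * inv y − b * 1#             ≡⟨ cong (λ z → a * inv y − b * z) (sym (*-inverseʳ y≢0)) ⟩
    a * inv y − b * (y * inv y)    ≡⟨ solve 4 (λ a b y i → a :* i :- b :* (y :* i) := (a :- b :* y) :* i) refl a b y (inv y) ⟩
    (a − b * y) * inv y            ∎
    where open ≡-Reasoning

  *-inv-cancel : ∀ {w} x → w ≢ 0# → (x * w) * inv w ≡ x
  *-inv-cancel {w} x w≢0 = trans (*-assoc x w (inv w)) (trans (cong (x *_) (*-inverseʳ w≢0)) (*-identityʳ x))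

δ : ∀ {P : Set} → Dec P → ℤ
δ d = + indicator d

δ-⇔ : ∀ {P Q : Set} (p : Dec P) (q : Dec Q) → (P → Q) → (Q → P) → δ p ≡ δ q
δ-⇔ (yes _) (yes _) _ _ = refl
δ-⇔ (yes p) (no ¬q) f _ = ⊥-elim (¬q (f p))
δ-⇔ (no ¬p) (yes q) _ g = ⊥-elim (¬p (g q))
δ-⇔ (no _) (no _) _ _ = refl

δ-yes : ∀ {P : Set} (d : Dec P) → P → δ d ≡ 1ℤ
δ-yes (yes _) _ = refl
δ-yes (no ¬p) p = ⊥-elim (¬p p)

δ-no : ∀ {P : Set} (d : Dec P) → ¬ P → δ d ≡ 0ℤ
δ-no (yes p) ¬p = ⊥-elim (¬p p)
δ-no (no _) _ = refl

[_]ᵇ : Bool → ℤ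
[ true ]ᵇ = 1ℤ
[ false ]ᵇ = 0ℤ

module FinSums where
  open SemiringSum ℤP.+-*-semiring public
    using (sum; sum-cong-≗; ∑-distrib-+; ∑-comm; *-distribˡ-sum; sum-permute; sum-replicate-zero; sum-remove)

  sum-one : ∀ n → sum {n} (λ _ → 1ℤ) ≡ + n
  sum-one zero = refl
  sum-one (suc n) = cong (λ s → 1ℤ ℤ.+ s) (sum-one n)

  sum-zero : ∀ {n} (t : Fin n → ℤ) → (∀ i → t i ≡ 0ℤ) → sum t ≡ 0ℤ
  sum-zero {n} t t≡0 = trans (sum-cong-≗ t≡0) (sum-replicate-zero n)

  sum-δ : ∀ {n} (k : Fin n) (g : Fin n → ℤ) → sum (λ i → δ (k FinP.≟ i) ℤ.* g i) ≡ g k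
  sum-δ {suc n} Fin.zero g = begin
    1ℤ ℤ.* g Fin.zero ℤ.+ sum (λ i → δ (Fin.zero FinP.≟ Fin.suc i) ℤ.* g (Fin.suc i))
      ≡⟨ cong₂ ℤ._+_ (ℤP.*-identityˡ (g Fin.zero)) (sum-zero (λ i → 0ℤ ℤ.* g (Fin.suc i)) (λ i → ℤP.*-zeroˡ (g (Fin.suc i)))) ⟩
    g Fin.zero ℤ.+ 0ℤ ≡⟨ ℤP.+-identityʳ (g Fin.zero) ⟩
    g Fin.zero ∎
    where open ≡-Reasoning
  sum-δ {suc n} (Fin.suc k) g = begin
    0ℤ ℤ.* g Fin.zero ℤ.+ sum (λ i → δ (Fin.suc k FinP.≟ Fin.suc i) ℤ.* g (Fin.suc i))
      ≡⟨ cong₂ ℤ._+_ (ℤP.*-zeroˡ (g Fin.zero)) (sum-cong-≗ (λ i → cong (ℤ._* g (Fin.suc i)) (shift i))) ⟩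
    0ℤ ℤ.+ sum (λ i → δ (k FinP.≟ i) ℤ.* g (Fin.suc i)) ≡⟨ ℤP.+-identityˡ _ ⟩
    sum (λ i → δ (k FinP.≟ i) ℤ.* g (Fin.suc i)) ≡⟨ sum-δ k (λ i → g (Fin.suc i)) ⟩
    g (Fin.suc k) ∎
    where
    open ≡-Reasoning
    shift : ∀ i → δ (Fin.suc k FinP.≟ Fin.suc i) ≡ δ (k FinP.≟ i)
    shift i = δ-⇔ (Fin.suc k FinP.≟ Fin.suc i) (k FinP.≟ i) FinP.suc-injective (cong Fin.suc)

  sum-nonpositive : ∀ {n} (t : Fin n → ℤ) → (∀ i → t i ℤ.≤ 0ℤ) → sum t ℤ.≤ 0ℤ
  sum-nonpositive {zero} t _ = ℤP.≤-refl
  sum-nonpositive {suc n} t t≤0 = ℤP.+-mono-≤ (t≤0 Fin.zero) (sum-nonpositive (λ i → t (Fin.suc i)) (λ i → t≤0 (Fin.suc i)))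

  nonpositive-sum-zero : ∀ {n} (t : Fin n → ℤ) → (∀ i → t i ℤ.≤ 0ℤ) → sum t ≡ 0ℤ → ∀ i → t i ≡ 0ℤ
  nonpositive-sum-zero {suc n} t t≤0 sum≡0 i = ℤP.≤-antisym (t≤0 i) (begin
    0ℤ                               ≡⟨ sym sum≡0 ⟩
    sum t                            ≡⟨ sum-remove {i = i} t ⟩
    t i ℤ.+ sum (λ j → t (Fin.punchIn i j)) ≤⟨ ℤP.+-monoʳ-≤ (t i) (sum-nonpositive _ (λ j → t≤0 (Fin.punchIn i j))) ⟩
    t i ℤ.+ 0ℤ                       ≡⟨ ℤP.+-identityʳ (t i) ⟩
    t i                              ∎)
    where open ℤP.≤-Reasoning

module FieldSums {q : ℕ} (F : FiniteField q) where
  open FiniteField F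
  open FieldArithmetic F public
  open FinSums

  from : Carrier → Fin q
  from = Inverse.from enumeration

  enum-from : ∀ x → enum (from x) ≡ x
  enum-from = Inverse.strictlyInverseˡ enumeration

  from-enum : ∀ i → from (enum i) ≡ i
  from-enum = Inverse.strictlyInverseʳ enumeration

  -- the position of an element in the enumeration (used to break symmetries)
  index : Carrier → ℕ
  index x = toℕ (from x)

  index-injective : ∀ {x y} → index x ≡ index y → x ≡ y
  index-injective {x} {y} e = trans (sym (enum-from x)) (trans (cong enum (FinP.toℕ-injective e)) (enum-from y))

  ∑ : (Carrier → ℤ) → ℤ
  ∑ f = sum (λ i → f (enum i))

  ∑-cong : ∀ {f g : Carrier → ℤ} → (∀ x → f x ≡ g x) → ∑ f ≡ ∑ g
  ∑-cong f≗g = sum-cong-≗ (λ i → f≗g (enum i))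

  ∑-+ : ∀ (f g : Carrier → ℤ) → ∑ (λ x → f x ℤ.+ g x) ≡ ∑ f ℤ.+ ∑ g
  ∑-+ f g = ∑-distrib-+ (λ i → f (enum i)) (λ i → g (enum i))

  ∑-*ˡ : ∀ c (f : Carrier → ℤ) → ∑ (λ x → c ℤ.* f x) ≡ c ℤ.* ∑ f
  ∑-*ˡ c f = sym (*-distribˡ-sum c (λ i → f (enum i)))

  ∑-*ʳ : ∀ c (f : Carrier → ℤ) → ∑ (λ x → f x ℤ.* c) ≡ ∑ f ℤ.* c
  ∑-*ʳ c f = trans (∑-cong (λ x → ℤP.*-comm (f x) c)) (trans (∑-*ˡ c f) (ℤP.*-comm c _))

  ∑-zero : ∑ (λ _ → 0ℤ) ≡ 0ℤ
  ∑-zero = sum-zero {q} (λ _ → 0ℤ) (λ _ → refl)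

  ∑-one : ∑ (λ _ → 1ℤ) ≡ + q
  ∑-one = sum-one q

  ∑-swap : ∀ (g : Carrier → Carrier → ℤ) → ∑ (λ x → ∑ (λ y → g x y)) ≡ ∑ (λ y → ∑ (λ x → g x y))
  ∑-swap g = ∑-comm (λ i j → g (enum i) (enum j))

  ∑-δ : ∀ c (g : Carrier → ℤ) → ∑ (λ t → δ (c ≟ t) ℤ.* g t) ≡ g c
  ∑-δ c g = begin
    sum (λ i → δ (c ≟ enum i) ℤ.* g (enum i))        ≡⟨ sum-cong-≗ (λ i → cong (ℤ._* g (enum i)) (same-δ i)) ⟩
    sum (λ i → δ (from c FinP.≟ i) ℤ.* g (enum i))   ≡⟨ sum-δ (from c) (λ i → g (enum i)) ⟩
    g (enum (from c))                                ≡⟨ cong g (enum-from c) ⟩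
    g c                                              ∎
    where
    open ≡-Reasoning
    same-δ : ∀ i → δ (c ≟ enum i) ≡ δ (from c FinP.≟ i)
    same-δ i = δ-⇔ (c ≟ enum i) (from c FinP.≟ i)
      (λ e → trans (cong from e) (from-enum i)) (λ e → trans (sym (enum-from c)) (cong enum e))

  ∑-δ-one : ∀ c → ∑ (λ t → δ (c ≟ t)) ≡ 1ℤ
  ∑-δ-one c = trans (∑-cong (λ t → sym (ℤP.*-identityʳ (δ (c ≟ t))))) (∑-δ c (λ _ → 1ℤ))

  ∑-reindex : ∀ (φ ψ : Carrier → Carrier) → (∀ x → ψ (φ x) ≡ x) → (∀ y → φ (ψ y) ≡ y) →
    (g : Carrier → ℤ) → ∑ (λ x → g (φ x)) ≡ ∑ g
  ∑-reindex φ ψ ψφ φψ g = sym (begin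
    sum (λ i → g (enum i))             ≡⟨ sum-permute (λ i → g (enum i)) π ⟩
    sum (λ i → g (enum (from (φ (enum i))))) ≡⟨ sum-cong-≗ (λ i → cong g (enum-from (φ (enum i)))) ⟩
    sum (λ i → g (φ (enum i)))         ∎)
    where
    open ≡-Reasoning
    conj : (Carrier → Carrier) → Fin q → Fin q
    conj h i = from (h (enum i))
    conj-inverse : ∀ {h k} → (∀ x → h (k x) ≡ x) → ∀ i → conj h (conj k i) ≡ i
    conj-inverse {h} {k} hk i = trans (cong (λ z → from (h z)) (enum-from (k (enum i)))) (trans (cong from (hk (enum i))) (from-enum i))
    π : Permutation q q
    π = permutation (conj φ) (conj ψ) (conj-inverse {φ} {ψ} φψ) (conj-inverse {ψ} {φ} ψφ)

  ∑-affine : ∀ {a} (b : Carrier) → a ≢ 0# → (g : Carrier → ℤ) → ∑ (λ x → g (a * x + b)) ≡ ∑ g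
  ∑-affine {a} b a≢0 g = ∑-reindex (λ x → a * x + b) (λ y → inv a * (y − b))
    (λ x → by-inverse x (*-inverseˡ a≢0)
       (solve 4 (λ a b x i → i :* ((a :* x :+ b) :- b) := x :+ (i :* a :- con (+ 1)) :* x) refl a b x (inv a)))
    (λ y → by-inverse (y − b) (*-inverseʳ a≢0)
       (solve 4 (λ a b y i → a :* (i :* (y :- b)) :+ b := y :+ (a :* i :- con (+ 1)) :* (y :- b)) refl a b y (inv a)))
    g

  ∑-nonpositive-zero : ∀ (f : Carrier → ℤ) → (∀ x → f x ℤ.≤ 0ℤ) → ∑ f ≡ 0ℤ → ∀ x → f x ≡ 0ℤ
  ∑-nonpositive-zero f f≤0 ∑≡0 x =
    trans (cong f (sym (enum-from x))) (nonpositive-sum-zero (λ i → f (enum i)) (λ i → f≤0 (enum i)) ∑≡0 (from x))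

  ∑-fibres : ∀ (w : Carrier → ℤ) (φ : Carrier → Carrier) (g : Carrier → ℤ) →
    ∑ (λ x → w x ℤ.* g (φ x)) ≡ ∑ (λ t → g t ℤ.* ∑ (λ x → w x ℤ.* δ (φ x ≟ t)))
  ∑-fibres w φ g = begin
    ∑ (λ x → w x ℤ.* g (φ x))                              ≡⟨ ∑-cong (λ x → cong (w x ℤ.*_) (sym (∑-δ (φ x) g))) ⟩
    ∑ (λ x → w x ℤ.* ∑ (λ t → δ (φ x ≟ t) ℤ.* g t))         ≡⟨ ∑-cong (λ x → sym (∑-*ˡ (w x) (λ t → δ (φ x ≟ t) ℤ.* g t))) ⟩
    ∑ (λ x → ∑ (λ t → w x ℤ.* (δ (φ x ≟ t) ℤ.* g t)))       ≡⟨ ∑-swap (λ x t → w x ℤ.* (δ (φ x ≟ t) ℤ.* g t)) ⟩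
    ∑ (λ t → ∑ (λ x → w x ℤ.* (δ (φ x ≟ t) ℤ.* g t)))       ≡⟨ ∑-cong (λ t → ∑-cong (λ x → sym (ℤP.*-assoc (w x) (δ (φ x ≟ t)) (g t)))) ⟩
    ∑ (λ t → ∑ (λ x → (w x ℤ.* δ (φ x ≟ t)) ℤ.* g t))       ≡⟨ ∑-cong (λ t → ∑-*ʳ (g t) (λ x → w x ℤ.* δ (φ x ≟ t))) ⟩
    ∑ (λ t → ∑ (λ x → w x ℤ.* δ (φ x ≟ t)) ℤ.* g t)         ≡⟨ ∑-cong (λ t → ℤP.*-comm (∑ (λ x → w x ℤ.* δ (φ x ≟ t))) (g t)) ⟩
    ∑ (λ t → g t ℤ.* ∑ (λ x → w x ℤ.* δ (φ x ≟ t)))         ∎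
    where open ≡-Reasoning

  count : (Carrier → Bool) → ℤ
  count P = ∑ (λ x → [ P x ]ᵇ)

exactly-one-smaller : ∀ m n → m ≢ n → [ m <ᵇ n ]ᵇ ℤ.+ [ n <ᵇ m ]ᵇ ≡ 1ℤ
exactly-one-smaller zero zero m≢n = ⊥-elim (m≢n refl)
exactly-one-smaller zero (suc n) _ = refl
exactly-one-smaller (suc m) zero _ = refl
exactly-one-smaller (suc m) (suc n) m≢n = exactly-one-smaller m n (λ e → m≢n (cong suc e))

-- Counting by orbits.  A fixed-point-free involution α of a finite set P
-- splits P into pairs {x, α x}; choosing the member of smaller index as the
-- representative shows  #P = 2 · #Rep.
module Pairing {q : ℕ} (F : FiniteField q) (P : FiniteField.Carrier F → Bool)
               (α : FiniteField.Carrier F → FiniteField.Carrier F)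
               (α-closed : ∀ x → P x ≡ true → P (α x) ≡ true)
               (α-involutive : ∀ x → P x ≡ true → α (α x) ≡ x)
               (α-free : ∀ x → P x ≡ true → α x ≢ x) where
  open FiniteField F
  open FieldSums F

  Rep : Carrier → Bool
  Rep x = P x ∧ (index x <ᵇ index (α x))

  private
    α̂ : Carrier → Carrier
    α̂ x with P x
    ... | true = α x
    ... | false = x

    α̂-involutive : ∀ x → α̂ (α̂ x) ≡ x
    α̂-involutive x with P x in Px
    ... | false rewrite Px = refl
    ... | true rewrite α-closed x Px = α-involutive x Px

    split : ∀ x → [ P x ]ᵇ ≡ [ Rep x ]ᵇ ℤ.+ [ Rep (α̂ x) ]ᵇ
    split x with P x in Px
    ... | false rewrite Px = refl
    ... | true rewrite α-closed x Px | α-involutive x Px =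
      sym (exactly-one-smaller (index x) (index (α x)) (λ e → α-free x Px (sym (index-injective e))))

  count-pairs : count P ≡ + 2 ℤ.* count Rep
  count-pairs = begin
    ∑ (λ x → [ P x ]ᵇ)                                  ≡⟨ ∑-cong split ⟩
    ∑ (λ x → [ Rep x ]ᵇ ℤ.+ [ Rep (α̂ x) ]ᵇ)             ≡⟨ ∑-+ (λ x → [ Rep x ]ᵇ) (λ x → [ Rep (α̂ x) ]ᵇ) ⟩
    count Rep ℤ.+ ∑ (λ x → [ Rep (α̂ x) ]ᵇ)              ≡⟨ cong (λ s → count Rep ℤ.+ s) (∑-reindex α̂ α̂ α̂-involutive α̂-involutive (λ x → [ Rep x ]ᵇ)) ⟩
    count Rep ℤ.+ count Rep                             ≡⟨ doubling (count Rep) ⟩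
    + 2 ℤ.* count Rep                                   ∎
    where
    open ≡-Reasoning
    doubling : ∀ a → a ℤ.+ a ≡ + 2 ℤ.* a
    doubling = solve-∀

  rep⇒P : ∀ x → Rep x ≡ true → P x ≡ true
  rep⇒P x Rx with P x
  ... | true = refl
  ... | false = Rx

  partner-rep : ∀ x → P x ≡ true → Rep x ≡ false → Rep (α x) ≡ true
  partner-rep x Px ¬Rx with split x
  ... | e rewrite Px | ¬Rx | α-closed x Px = one _ e
    where
    one : ∀ b → 1ℤ ≡ 0ℤ ℤ.+ [ b ]ᵇ → b ≡ true
    one true _ = refl
    one false ()

  partner-not-rep : ∀ x → Rep x ≡ true → Rep (α x) ≡ false
  partner-not-rep x Rx with rep⇒P x Rx | split x
  ... | Px | e rewrite Px | Rx = zero′ _ e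
    where
    zero′ : ∀ b → 1ℤ ≡ 1ℤ ℤ.+ [ b ]ᵇ → b ≡ false
    zero′ false _ = refl
    zero′ true ()

-- Two commuting involutions α, β such that α, β and αβ have no fixed points
-- on P generate a Klein four-group acting freely on P, so  4 ∣ #P.
-- Pair by α first; on the α-representatives, β induces the involution
-- x ↦ (β x or α β x, whichever is a representative), and we pair again.
module KleinFour {q : ℕ} (F : FiniteField q) (P : FiniteField.Carrier F → Bool)
       (α β : FiniteField.Carrier F → FiniteField.Carrier F)
       (α-closed : ∀ x → P x ≡ true → P (α x) ≡ true)
       (β-closed : ∀ x → P x ≡ true → P (β x) ≡ true)
       (α-involutive : ∀ x → P x ≡ true → α (α x) ≡ x)
       (β-involutive : ∀ x → P x ≡ true → β (β x) ≡ x)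
       (αβ-commute : ∀ x → P x ≡ true → α (β x) ≡ β (α x))
       (α-free : ∀ x → P x ≡ true → α x ≢ x)
       (β-free : ∀ x → P x ≡ true → β x ≢ x)
       (αβ-free : ∀ x → P x ≡ true → α (β x) ≢ x) where
  open FiniteField F
  open FieldSums F
  open Pairing F P α α-closed α-involutive α-free

  private
    choose : Bool → Carrier → Carrier
    choose true x = β x
    choose false x = α (β x)

    β̂ : Carrier → Carrier
    β̂ x = choose (Rep (β x)) x

    β̂-closed : ∀ x → Rep x ≡ true → Rep (β̂ x) ≡ true
    β̂-closed x Rx with Rep (β x) in Rβx
    ... | true = Rβx
    ... | false = partner-rep (β x) (β-closed x (rep⇒P x Rx)) Rβx

    β̂-involutive : ∀ x → Rep x ≡ true → β̂ (β̂ x) ≡ x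
    β̂-involutive x Rx with Rep (β x) in Rβx
    ... | true rewrite β-involutive x (rep⇒P x Rx) | Rx = β-involutive x (rep⇒P x Rx)
    ... | false = back
      where
      Px : P x ≡ true
      Px = rep⇒P x Rx
      βαβ : β (α (β x)) ≡ α x
      βαβ = trans (cong β (αβ-commute x Px)) (β-involutive (α x) (α-closed x Px))
      back : choose (Rep (β (α (β x)))) (α (β x)) ≡ x
      back rewrite βαβ | partner-not-rep x Rx = trans (cong α βαβ) (α-involutive x Px)

    β̂-free : ∀ x → Rep x ≡ true → β̂ x ≢ x
    β̂-free x Rx with Rep (β x)
    ... | true = β-free x (rep⇒P x Rx)
    ... | false = αβ-free x (rep⇒P x Rx)

  module SecondPairing = Pairing F Rep β̂ β̂-closed β̂-involutive β̂-free

  count-quadruples : count P ≡ + 4 ℤ.* count SecondPairing.Rep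
  count-quadruples = begin
    count P                                     ≡⟨ count-pairs ⟩
    + 2 ℤ.* count Rep                           ≡⟨ cong (+ 2 ℤ.*_) SecondPairing.count-pairs ⟩
    + 2 ℤ.* (+ 2 ℤ.* count SecondPairing.Rep)   ≡⟨ sym (ℤP.*-assoc (+ 2) (+ 2) _) ⟩
    + 4 ℤ.* count SecondPairing.Rep             ∎
    where open ≡-Reasoning

not-multiple : ∀ k n (j : ℤ) → 0 ℕ.< k → k ℕ.< n → + k ≢ + n ℤ.* j
not-multiple k n j 0<k k<n e = impossible ℤ.∣ j ∣ (trans (cong ℤ.∣_∣ e) (ℤP.abs-* (+ n) j))
  where
  impossible : ∀ m → k ≢ n ℕ.* m
  impossible zero e′ = ℕP.<-irrefl (sym (trans e′ (ℕP.*-zeroʳ n))) 0<k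
  impossible (suc m) e′ = ℕP.<-irrefl refl (ℕP.<-≤-trans k<n (ℕP.≤-trans (ℕP.m≤m*n n (suc m)) (ℕP.≤-reflexive (sym e′))))

residues-differ : ∀ n r s (a b : ℤ) → r ℕ.< s → s ℕ.< n → + r ℤ.+ + n ℤ.* a ≢ + s ℤ.+ + n ℤ.* b
residues-differ n r s a b r<s s<n e = not-multiple (s ℕ.∸ r) n (a ℤ.- b) (ℕP.m<n⇒0<n∸m r<s)
  (ℕP.≤-<-trans (ℕP.m∸n≤m s r) s<n) (begin
    + (s ℕ.∸ r)                       ≡⟨ sym (ℤP.⊖-≥ (ℕP.<⇒≤ r<s)) ⟩
    s ⊖ r                             ≡⟨ sym (ℤP.m-n≡m⊖n s r) ⟩
    + s ℤ.- + r                       ≡⟨ subtract (+ r) (+ s) (+ n ℤ.* b) ⟩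
    (+ s ℤ.+ + n ℤ.* b) ℤ.- + r ℤ.- + n ℤ.* b ≡⟨ cong (λ t → t ℤ.- + r ℤ.- + n ℤ.* b) (sym e) ⟩
    (+ r ℤ.+ + n ℤ.* a) ℤ.- + r ℤ.- + n ℤ.* b ≡⟨ factor (+ r) (+ n) a b ⟩
    + n ℤ.* (a ℤ.- b)                 ∎)
  where
  open ≡-Reasoning
  subtract : ∀ r s c → s ℤ.- r ≡ (s ℤ.+ c) ℤ.- r ℤ.- c
  subtract = solve-∀
  factor : ∀ r n a b → (r ℤ.+ n ℤ.* a) ℤ.- r ℤ.- n ℤ.* b ≡ n ℤ.* (a ℤ.- b)
  factor = solve-∀

multiple-of : ∀ k (a : ℤ) n → (+ k) ℤD.∣ (a ℤ.- (a ℤ.- + n)) → ∃ λ m → + n ≡ + k ℤ.* m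
multiple-of k a n k∣ with subst (λ z → k ℕD.∣ ℤ.∣ z ∣) (cancel a (+ n)) k∣
  where
  cancel : ∀ a b → a ℤ.- (a ℤ.- b) ≡ b
  cancel = solve-∀
... | ℕD.divides m n≡m*k = + m , trans (cong +_ (trans n≡m*k (ℕP.*-comm m k))) (ℤP.pos-* k m)

q-residue : ∀ q → q % 4 ≡ 1 → + q ≡ + 1 ℤ.+ + 4 ℤ.* + (q / 4)
q-residue q q≡1 = trans (cong +_ (trans (ℕDivMod.m≡m%n+[m/n]*n q 4) (cong₂ ℕ._+_ q≡1 (ℕP.*-comm (q / 4) 4))))
  (trans (ℤP.pos-+ 1 (4 ℕ.* (q / 4))) (cong (λ t → + 1 ℤ.+ t) (ℤP.pos-* 4 (q / 4))))

does-true : ∀ {A : Set} (d : Dec A) → does d ≡ true → A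
does-true (yes a) _ = a
does-true (no _) ()

module OddField {q : ℕ} (F : FiniteField q) (q≡1 : q % 4 ≡ 1) where
  open FiniteField F
  open FieldSums F public

  -- If 2 = 0, then x ↦ x + 1 is a fixed-point-free involution, so q is even.
  two≢0 : two ≢ 0#
  two≢0 two≡0 = residues-differ 2 0 1 (count Rep) (+ 2 ℤ.* + (q / 4)) (ℕ.s≤s ℕ.z≤n) ℕP.≤-refl (begin
      + 0 ℤ.+ + 2 ℤ.* count Rep          ≡⟨ ℤP.+-identityˡ _ ⟩
      + 2 ℤ.* count Rep                  ≡⟨ sym count-pairs ⟩
      ∑ (λ _ → 1ℤ)                       ≡⟨ ∑-one ⟩
      + q                                ≡⟨ q-residue q q≡1 ⟩
      + 1 ℤ.+ + 4 ℤ.* + (q / 4)          ≡⟨ cong (λ t → + 1 ℤ.+ t) (ℤP.*-assoc (+ 2) (+ 2) (+ (q / 4))) ⟩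
      + 1 ℤ.+ + 2 ℤ.* (+ 2 ℤ.* + (q / 4)) ∎)
    where
    open ≡-Reasoning
    shift : Carrier → Carrier
    shift x = x + 1#
    shift-involutive : ∀ x → true ≡ true → shift (shift x) ≡ x
    shift-involutive x _ = trans (+-assoc x 1# 1#) (trans (cong (λ t → x + t) two≡0) (+-identityʳ x))
    shift-free : ∀ x → true ≡ true → shift x ≢ x
    shift-free x _ e = 1≢0 (begin
      1#               ≡⟨ solve 2 (λ x y → con (+ 1) := (:- x) :+ (x :+ con (+ 1))) refl x 1# ⟩
      - x + (x + 1#)   ≡⟨ cong (λ t → - x + t) e ⟩
      - x + x          ≡⟨ -‿inverseˡ x ⟩
      0#               ∎)
    open Pairing F (λ _ → true) shift (λ _ _ → refl) shift-involutive shift-free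

  neg-free : ∀ {x} → x ≢ 0# → - x ≢ x
  neg-free {x} x≢0 e with no-zero-divisors {two} {x} 2x≡0
    where
    2x≡0 : two * x ≡ 0#
    2x≡0 = trans (solve 1 (λ x → con (+ 2) :* x := x :+ x) refl x) (trans (cong (_+ x) (sym e)) (-‿inverseˡ x))
  ... | inj₁ two≡0 = two≢0 two≡0
  ... | inj₂ x≡0 = x≢0 x≡0

  neg-nonzero : ∀ {x} → x ≢ 0# → - x ≢ 0#
  neg-nonzero {x} x≢0 e = x≢0 (trans (sym (-‿involutive x)) (trans (cong -_ e) -0≡0))

  1≢-1 : 1# ≢ - 1#
  1≢-1 e = neg-free 1≢0 (sym e)

  -1≢0 : - 1# ≢ 0#
  -1≢0 = neg-nonzero 1≢0

  square? : ∀ d → Dec (IsSquare F d)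
  square? d with FinP.any? (λ i → d ≟ (enum i * enum i))
  ... | yes (i , e) = yes (enum i , e)
  ... | no none = no (λ { (y , e) → none (from y , trans e (cong (λ z → z * z) (sym (enum-from y)))) })

  -- If −1 is not a square, the Klein four-group {id, x ↦ −x, x ↦ 1/x, x ↦ −1/x}
  -- acts freely on  F ∖ {0, 1, −1},  so  q ≡ 3 (mod 4).
  -1-square : IsSquare F (- 1#)
  -1-square with square? (- 1#)
  ... | yes s = s
  ... | no -1-nonsquare = ⊥-elim (residues-differ 4 1 3 (+ (q / 4)) (count SecondPairing.Rep) (ℕ.s≤s (ℕ.s≤s ℕ.z≤n)) ℕP.≤-refl (begin
      + 1 ℤ.+ + 4 ℤ.* + (q / 4)                ≡⟨ sym (q-residue q q≡1) ⟩
      + q                                      ≡⟨ sym ∑-one ⟩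
      ∑ (λ _ → 1ℤ)                             ≡⟨ ∑-cong (λ x → sym (decompose x)) ⟩
      ∑ (λ x → [ P x ]ᵇ ℤ.+ excluded x)        ≡⟨ ∑-+ (λ x → [ P x ]ᵇ) excluded ⟩
      count P ℤ.+ ∑ excluded                   ≡⟨ cong₂ ℤ._+_ count-quadruples three-excluded ⟩
      + 4 ℤ.* count SecondPairing.Rep ℤ.+ + 3  ≡⟨ ℤP.+-comm (+ 4 ℤ.* count SecondPairing.Rep) (+ 3) ⟩
      + 3 ℤ.+ + 4 ℤ.* count SecondPairing.Rep  ∎))
    where
    open ≡-Reasoning
    Generic : Carrier → Set
    Generic x = x ≢ 0# × x * x ≢ 1#
    P : Carrier → Bool
    P x = does (¬? (x ≟ 0#) ×-dec ¬? ((x * x) ≟ 1#))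
    generic : ∀ x → P x ≡ true → Generic x
    generic x = does-true (¬? (x ≟ 0#) ×-dec ¬? ((x * x) ≟ 1#))
    P-intro : ∀ x → Generic x → P x ≡ true
    P-intro x = dec-true (¬? (x ≟ 0#) ×-dec ¬? ((x * x) ≟ 1#))

    neg-closed : ∀ x → P x ≡ true → P (- x) ≡ true
    neg-closed x Px with generic x Px
    ... | x≢0 , xx≢1 = P-intro (- x) (neg-nonzero x≢0 , λ e → xx≢1 (trans (sym (neg-square x)) e))
    inv-closed : ∀ x → P x ≡ true → P (inv x) ≡ true
    inv-closed x Px with generic x Px
    ... | x≢0 , xx≢1 = P-intro (inv x) (inv-nonzero x≢0 ,
          λ e → xx≢1 (trans (sym (inv-involutive (x * x))) (trans (cong inv (trans (inv-* x x) e)) inv-1)))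
    inv-free : ∀ x → P x ≡ true → inv x ≢ x
    inv-free x Px e with generic x Px
    ... | x≢0 , xx≢1 = xx≢1 (trans (cong (x *_) (sym e)) (*-inverseʳ x≢0))
    neg-inv-free : ∀ x → P x ≡ true → - inv x ≢ x
    neg-inv-free x Px e with generic x Px
    ... | x≢0 , _ = -1-nonsquare (x , sym (begin
      x * x           ≡⟨ cong (x *_) (sym e) ⟩
      x * - inv x     ≡⟨ sym (-‿distribʳ-* x (inv x)) ⟩
      - (x * inv x)   ≡⟨ cong -_ (*-inverseʳ x≢0) ⟩
      - 1#            ∎))

    open KleinFour F P -_ inv neg-closed inv-closed (λ x _ → -‿involutive x) (λ x _ → inv-involutive x)
      (λ x _ → sym (inv-neg x)) (λ x Px → neg-free (proj₁ (generic x Px))) inv-free neg-inv-free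

    excluded : Carrier → ℤ
    excluded x = δ (0# ≟ x) ℤ.+ (δ (1# ≟ x) ℤ.+ δ ((- 1#) ≟ x))

    three-excluded : ∑ excluded ≡ + 3
    three-excluded = begin
      ∑ excluded                                           ≡⟨ ∑-+ (λ x → δ (0# ≟ x)) (λ x → δ (1# ≟ x) ℤ.+ δ ((- 1#) ≟ x)) ⟩
      ∑ (λ x → δ (0# ≟ x)) ℤ.+ ∑ (λ x → δ (1# ≟ x) ℤ.+ δ ((- 1#) ≟ x)) ≡⟨ cong₂ ℤ._+_ (∑-δ-one 0#) (∑-+ (λ x → δ (1# ≟ x)) (λ x → δ ((- 1#) ≟ x))) ⟩
      1ℤ ℤ.+ (∑ (λ x → δ (1# ≟ x)) ℤ.+ ∑ (λ x → δ ((- 1#) ≟ x))) ≡⟨ cong (λ t → 1ℤ ℤ.+ t) (cong₂ ℤ._+_ (∑-δ-one 1#) (∑-δ-one (- 1#))) ⟩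
      + 3                                                  ∎

    tally : ∀ b {u v w u′ v′ w′} → u ≡ u′ → v ≡ v′ → w ≡ w′ →
      [ b ]ᵇ ℤ.+ (u ℤ.+ (v ℤ.+ w)) ≡ [ b ]ᵇ ℤ.+ (u′ ℤ.+ (v′ ℤ.+ w′))
    tally b refl refl refl = refl

    decompose : ∀ x → [ P x ]ᵇ ℤ.+ excluded x ≡ 1ℤ
    decompose x with x ≟ 0#
    ... | yes refl = tally false (δ-yes (0# ≟ 0#) refl) (δ-no (1# ≟ 0#) 1≢0) (δ-no ((- 1#) ≟ 0#) -1≢0)
    ... | no x≢0 with (x * x) ≟ 1#
    ...   | no xx≢1 = tally true (δ-no (0# ≟ x) (λ e → x≢0 (sym e)))
                                 (δ-no (1# ≟ x) (λ e → xx≢1 (trans (cong (λ z → z * z) (sym e)) (*-identityˡ 1#))))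
                                 (δ-no ((- 1#) ≟ x) (λ e → xx≢1 (trans (cong (λ z → z * z) (sym e)) (trans (neg-square 1#) (*-identityˡ 1#)))))
    ...   | yes xx≡1 with square-one xx≡1
    ...     | inj₁ refl = tally false (δ-no (0# ≟ 1#) (λ e → 1≢0 (sym e))) (δ-yes (1# ≟ 1#) refl) (δ-no ((- 1#) ≟ 1#) (λ e → 1≢-1 (sym e)))
    ...     | inj₂ refl = tally false (δ-no (0# ≟ (- 1#)) (λ e → -1≢0 (sym e))) (δ-no (1# ≟ (- 1#)) 1≢-1) (δ-yes ((- 1#) ≟ (- 1#)) refl)

0≢1ℤ : 0ℤ ≢ 1ℤ
0≢1ℤ ()

-1≢1ℤ : -1ℤ ≢ 1ℤ
-1≢1ℤ ()

+-cancelˡ-ℤ : ∀ a {b c} → a ℤ.+ b ≡ a ℤ.+ c → b ≡ c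
+-cancelˡ-ℤ a {b} {c} e = trans (undo a b) (trans (cong (λ z → ℤ.- a ℤ.+ z) e) (sym (undo a c)))
  where
  undo : ∀ a b → b ≡ ℤ.- a ℤ.+ (a ℤ.+ b)
  undo = solve-∀

module QuadraticCharacter {q : ℕ} (F : FiniteField q) (q≡1 : q % 4 ≡ 1) where
  open FiniteField F
  open OddField F q≡1 public

  Square : Carrier → Set
  Square = IsSquare F

  square : ∀ x → Square (x * x)
  square x = x , refl

  zero-square : Square 0#
  zero-square = 0# , sym (zeroˡ 0#)

  χ : Carrier → ℤ
  χ d with d ≟ 0#
  ... | yes _ = 0ℤ
  ... | no _ with square? d
  ...   | yes _ = 1ℤ
  ...   | no _ = -1ℤ

  χ-zero : ∀ {d} → d ≡ 0# → χ d ≡ 0ℤ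
  χ-zero {d} d≡0 with d ≟ 0#
  ... | yes _ = refl
  ... | no d≢0 = ⊥-elim (d≢0 d≡0)

  χ-square : ∀ {d} → d ≢ 0# → Square d → χ d ≡ 1ℤ
  χ-square {d} d≢0 s with d ≟ 0#
  ... | yes d≡0 = ⊥-elim (d≢0 d≡0)
  ... | no _ with square? d
  ...   | yes _ = refl
  ...   | no ns = ⊥-elim (ns s)

  χ-nonsquare : ∀ {d} → ¬ Square d → χ d ≡ -1ℤ
  χ-nonsquare {d} ns with d ≟ 0#
  ... | yes refl = ⊥-elim (ns zero-square)
  ... | no _ with square? d
  ...   | yes s = ⊥-elim (ns s)
  ...   | no _ = refl

  χ≡1⇒square : ∀ {d} → χ d ≡ 1ℤ → Square d
  χ≡1⇒square {d} χd≡1 with square? d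
  ... | yes s = s
  ... | no ns = ⊥-elim (-1≢1ℤ (trans (sym (χ-nonsquare ns)) χd≡1))

  χ≤1 : ∀ d → χ d ℤ.≤ 1ℤ
  χ≤1 d with zero-or-nonzero d
  ... | inj₁ d≡0 rewrite χ-zero d≡0 = ℤ.+≤+ ℕ.z≤n
  ... | inj₂ d≢0 with square? d
  ...   | yes s rewrite χ-square d≢0 s = ℤP.≤-refl
  ...   | no ns rewrite χ-nonsquare ns = ℤ.-≤+

  χ-of-square : ∀ {x} → x ≢ 0# → χ (x * x) ≡ 1ℤ
  χ-of-square x≢0 = χ-square (*-nonzero x≢0 x≢0) (square _)

  roots : Carrier → ℤ
  roots c = ∑ (λ y → δ ((y * y) ≟ c))

  roots≡1+χ : ∀ c → roots c ≡ 1ℤ ℤ.+ χ c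
  roots≡1+χ c with zero-or-nonzero c
  ... | inj₁ refl rewrite χ-zero {0#} refl =
    trans (∑-cong (λ y → δ-⇔ ((y * y) ≟ 0#) (0# ≟ y) (λ e → sym (square-zero e)) (λ { refl → zeroˡ 0# }))) (∑-δ-one 0#)
  ... | inj₂ c≢0 with square? c
  ...   | no ns rewrite χ-nonsquare ns = trans (∑-cong (λ y → δ-no ((y * y) ≟ c) (λ e → ns (y , sym e)))) ∑-zero
  ...   | yes (w , c≡ww) rewrite χ-square c≢0 (w , c≡ww) = begin
      ∑ (λ y → δ ((y * y) ≟ c))                  ≡⟨ ∑-cong two-roots ⟩
      ∑ (λ y → δ (w ≟ y) ℤ.+ δ ((- w) ≟ y))      ≡⟨ ∑-+ (λ y → δ (w ≟ y)) (λ y → δ ((- w) ≟ y)) ⟩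
      ∑ (λ y → δ (w ≟ y)) ℤ.+ ∑ (λ y → δ ((- w) ≟ y)) ≡⟨ cong₂ ℤ._+_ (∑-δ-one w) (∑-δ-one (- w)) ⟩
      + 2                                       ∎
    where
    open ≡-Reasoning
    w≢0 : w ≢ 0#
    w≢0 w≡0 = c≢0 (trans c≡ww (trans (cong (λ z → z * z) w≡0) (zeroˡ 0#)))
    two-roots : ∀ y → δ ((y * y) ≟ c) ≡ δ (w ≟ y) ℤ.+ δ ((- w) ≟ y)
    two-roots y with y ≟ w | y ≟ (- w)
    ... | yes refl | _ = trans (δ-yes ((y * y) ≟ c) (sym c≡ww))
                           (sym (cong₂ ℤ._+_ (δ-yes (y ≟ y) refl) (δ-no ((- y) ≟ y) (neg-free w≢0))))
    ... | no _ | yes refl = trans (δ-yes (((- w) * (- w)) ≟ c) (trans (neg-square w) (sym c≡ww)))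
                              (sym (cong₂ ℤ._+_ (δ-no (w ≟ (- w)) (λ e → neg-free w≢0 (sym e))) (δ-yes ((- w) ≟ (- w)) refl)))
    ... | no y≢w | no y≢-w = trans (δ-no ((y * y) ≟ c) (λ e → [ y≢w , y≢-w ]′ (square-roots (trans e c≡ww))))
                               (sym (cong₂ ℤ._+_ (δ-no (w ≟ y) (λ e → y≢w (sym e))) (δ-no ((- w) ≟ y) (λ e → y≢-w (sym e)))))

  -- Σ χ = 0: summing  roots c = 1 + χ c  over c counts every y once.
  ∑χ≡0 : ∑ χ ≡ 0ℤ
  ∑χ≡0 = +-cancelˡ-ℤ (+ q) (begin
    + q ℤ.+ ∑ χ                         ≡⟨ cong (ℤ._+ ∑ χ) (sym ∑-one) ⟩
    ∑ (λ _ → 1ℤ) ℤ.+ ∑ χ                ≡⟨ sym (∑-+ (λ _ → 1ℤ) χ) ⟩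
    ∑ (λ c → 1ℤ ℤ.+ χ c)                ≡⟨ sym (∑-cong roots≡1+χ) ⟩
    ∑ (λ c → ∑ (λ y → δ ((y * y) ≟ c))) ≡⟨ ∑-swap (λ c y → δ ((y * y) ≟ c)) ⟩
    ∑ (λ y → ∑ (λ c → δ ((y * y) ≟ c))) ≡⟨ ∑-cong (λ y → ∑-δ-one (y * y)) ⟩
    ∑ (λ _ → 1ℤ)                        ≡⟨ ∑-one ⟩
    + q                                 ≡⟨ sym (ℤP.+-identityʳ (+ q)) ⟩
    + q ℤ.+ 0ℤ                          ∎)
    where open ≡-Reasoning

  square-product : ∀ {a b} → Square a → Square b → Square (a * b)
  square-product {a} {b} (y , a≡yy) (z , b≡zz) =
    y * z , trans (cong₂ _*_ a≡yy b≡zz) (solve 2 (λ y z → (y :* y) :* (z :* z) := (y :* z) :* (y :* z)) refl y z)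

  nonsquare-product : ∀ {s n} → s ≢ 0# → Square s → ¬ Square n → ¬ Square (n * s)
  nonsquare-product {s} {n} s≢0 (y , s≡yy) ns (w , ns≡ww) = ns (w * inv y , sym (begin
      (w * inv y) * (w * inv y)         ≡⟨ solve 2 (λ w i → (w :* i) :* (w :* i) := (w :* w) :* (i :* i)) refl w (inv y) ⟩
      (w * w) * (inv y * inv y)         ≡⟨ cong (_* (inv y * inv y)) (trans (sym ns≡ww) (cong (n *_) s≡yy)) ⟩
      (n * (y * y)) * (inv y * inv y)   ≡⟨ solve 3 (λ n y i → (n :* (y :* y)) :* (i :* i) := n :* ((y :* i) :* (y :* i))) refl n y (inv y) ⟩
      n * ((y * inv y) * (y * inv y))   ≡⟨ cong (λ z → n * (z * z)) (*-inverseʳ y≢0) ⟩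
      n * (1# * 1#)                     ≡⟨ solve 1 (λ n → n :* (con (+ 1) :* con (+ 1)) := n) refl n ⟩
      n                                 ∎))
    where
    open ≡-Reasoning
    y≢0 : y ≢ 0#
    y≢0 y≡0 = s≢0 (trans s≡yy (trans (cong (λ z → z * z) y≡0) (zeroˡ 0#)))

  -- The product of two non-squares n, m is a square: the function
  -- x ↦ χ x + χ (n x) is ≤ 0 everywhere and sums to 0, so it vanishes at m.
  nonsquare-nonsquare : ∀ {n m} → ¬ Square n → ¬ Square m → Square (n * m)
  nonsquare-nonsquare {n} {m} nn nm = χ≡1⇒square (+-cancelˡ-ℤ -1ℤ (trans (cong (ℤ._+ χ (n * m)) (sym (χ-nonsquare nm)))
                                                   (∑-nonpositive-zero h h≤0 ∑h≡0 m)))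
    where
    n≢0 : n ≢ 0#
    n≢0 refl = nn zero-square
    h : Carrier → ℤ
    h x = χ x ℤ.+ χ (n * x)
    ∑h≡0 : ∑ h ≡ 0ℤ
    ∑h≡0 = trans (∑-+ χ (λ x → χ (n * x))) (cong₂ ℤ._+_ ∑χ≡0 (trans (∑-cong (λ x → cong χ (sym (+-identityʳ (n * x))))) (trans (∑-affine 0# n≢0 χ) ∑χ≡0)))
    h≤0 : ∀ x → h x ℤ.≤ 0ℤ
    h≤0 x with zero-or-nonzero x
    ... | inj₁ refl rewrite zeroʳ n | χ-zero {0#} refl = ℤP.≤-refl
    ... | inj₂ x≢0 with square? x
    ...   | yes s rewrite χ-square x≢0 s | χ-nonsquare (nonsquare-product x≢0 s nn) = ℤP.≤-refl
    ...   | no ns rewrite χ-nonsquare ns = ℤP.+-monoʳ-≤ -1ℤ (χ≤1 (n * x))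

  χ-* : ∀ a b → χ (a * b) ≡ χ a ℤ.* χ b
  χ-* a b with zero-or-nonzero a | zero-or-nonzero b
  ... | inj₁ refl | _ rewrite zeroˡ b | χ-zero {0#} refl = refl
  ... | inj₂ _ | inj₁ refl rewrite zeroʳ a | χ-zero {0#} refl = sym (ℤP.*-zeroʳ (χ a))
  ... | inj₂ a≢0 | inj₂ b≢0 with square? a | square? b
  ...   | yes sa | yes sb rewrite χ-square a≢0 sa | χ-square b≢0 sb = χ-square (*-nonzero a≢0 b≢0) (square-product sa sb)
  ...   | yes sa | no nsb rewrite χ-square a≢0 sa | χ-nonsquare nsb =
    χ-nonsquare (λ s → nonsquare-product a≢0 sa nsb (subst Square (*-comm a b) s))
  ...   | no nsa | yes sb rewrite χ-nonsquare nsa | χ-square b≢0 sb = χ-nonsquare (nonsquare-product b≢0 sb nsa)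
  ...   | no nsa | no nsb rewrite χ-nonsquare nsa | χ-nonsquare nsb = χ-square (*-nonzero a≢0 b≢0) (nonsquare-nonsquare nsa nsb)

  χ-scale : ∀ {w} z → w ≢ 0# → χ ((w * w) * z) ≡ χ z
  χ-scale z w≢0 = trans (χ-* _ z) (trans (cong (ℤ._* χ z) (χ-of-square w≢0)) (ℤP.*-identityˡ (χ z)))

  χ-neg : ∀ z → χ (- z) ≡ χ z
  χ-neg z = trans (cong χ (sym (-1*x≈-x z))) (trans (χ-* (- 1#) z)
              (trans (cong (ℤ._* χ z) (χ-square -1≢0 -1-square)) (ℤP.*-identityˡ (χ z))))

sumFin-ℤ : ∀ n (f : Fin n → ℕ) → + sumFin n f ≡ FinSums.sum (λ i → + f i)
sumFin-ℤ zero f = refl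
sumFin-ℤ (suc n) f = trans (ℤP.pos-+ (f Fin.zero) _) (cong (λ t → + f Fin.zero ℤ.+ t) (sumFin-ℤ n (λ i → f (Fin.suc i))))

module LegendreSums {q : ℕ} (F : FiniteField q) (q≡1 : q % 4 ≡ 1) where
  open FiniteField F
  open QuadraticCharacter F q≡1 public

  legendre : Carrier → Carrier → Carrier
  legendre d x = x * (x − 1#) * (x − d)

  T : Carrier → ℤ
  T d = ∑ (λ x → χ (legendre d x))

  legendre-0 : ∀ d → legendre d 0# ≡ 0#
  legendre-0 d = trans (cong (_* (0# − d)) (zeroˡ (0# − 1#))) (zeroˡ _)

  affine-points : ∀ d → + affineCount F d ≡ ∑ (λ x → roots (legendre d x))
  affine-points d = trans (sumFin-ℤ q _) (FinSums.sum-cong-≗ (λ i → sumFin-ℤ q (λ j →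
    indicator ((enum j * enum j) ≟ legendre d (enum i)))))

  traceA≡-T : ∀ d → traceA F d ≡ ℤ.- T d
  traceA≡-T d = begin
    (+ q ℤ.+ + 1) ℤ.- + suc (affineCount F d)              ≡⟨ cong (λ z → (+ q ℤ.+ + 1) ℤ.- z) (ℤP.pos-+ 1 (affineCount F d)) ⟩
    (+ q ℤ.+ + 1) ℤ.- (+ 1 ℤ.+ + affineCount F d)          ≡⟨ cong (λ z → (+ q ℤ.+ + 1) ℤ.- (+ 1 ℤ.+ z)) affine≡q+T ⟩
    (+ q ℤ.+ + 1) ℤ.- (+ 1 ℤ.+ (+ q ℤ.+ T d))              ≡⟨ cancel (+ q) (T d) ⟩
    ℤ.- T d                                                ∎
    where
    open ≡-Reasoning
    cancel : ∀ a b → (a ℤ.+ + 1) ℤ.- (+ 1 ℤ.+ (a ℤ.+ b)) ≡ ℤ.- b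
    cancel = solve-∀
    affine≡q+T : + affineCount F d ≡ + q ℤ.+ T d
    affine≡q+T = begin
      + affineCount F d                          ≡⟨ affine-points d ⟩
      ∑ (λ x → roots (legendre d x))             ≡⟨ ∑-cong (λ x → roots≡1+χ (legendre d x)) ⟩
      ∑ (λ x → 1ℤ ℤ.+ χ (legendre d x))          ≡⟨ ∑-+ (λ _ → 1ℤ) (λ x → χ (legendre d x)) ⟩
      ∑ (λ _ → 1ℤ) ℤ.+ T d                       ≡⟨ cong (ℤ._+ T d) ∑-one ⟩
      + q ℤ.+ T d                                ∎

  -- x ↦ 1 − x turns the curve for d into the twist by −1 of the curve for 1 − d
  T-reflect : ∀ d → T (1# − d) ≡ T d
  T-reflect d = begin
    ∑ (λ x → χ (legendre (1# − d) x))            ≡⟨ sym (∑-affine 1# -1≢0 (λ x → χ (legendre (1# − d) x))) ⟩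
    ∑ (λ x → χ (legendre (1# − d) (- 1# * x + 1#))) ≡⟨ ∑-cong (λ x → trans (cong χ (reflect x)) (χ-neg _)) ⟩
    ∑ (λ x → χ (legendre d x))                   ∎
    where
    open ≡-Reasoning
    reflect : ∀ x → legendre (1# − d) (- 1# * x + 1#) ≡ - legendre d x
    reflect = solve 2 (λ d x → (((:- con (+ 1)) :* x :+ con (+ 1)) :* (((:- con (+ 1)) :* x :+ con (+ 1)) :- con (+ 1)))
                                 :* (((:- con (+ 1)) :* x :+ con (+ 1)) :- (con (+ 1) :- d))
                               := :- ((x :* (x :- con (+ 1))) :* (x :- d))) refl d

  four≢0 : two * two ≢ 0#
  four≢0 = *-nonzero two≢0 two≢0

  module Landen (u : Carrier) (u≢0 : u ≢ 0#) (s≢0 : 1# + u ≢ 0#) where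
    s c v : Carrier
    s = 1# + u
    c = 1# + u * u
    v = (1# − u) * inv s

    -- x ↦ x + u²/x, whose fibres are the roots of  x² − t x + u²
    φ : Carrier → Carrier
    φ x = x + (u * u) * inv x

    x·φx : ∀ {x} → x ≢ 0# → x * φ x ≡ x * x + u * u
    x·φx {x} x≢0 = begin
      x * (x + (u * u) * inv x)      ≡⟨ solve 3 (λ x u i → x :* (x :+ (u :* u) :* i) := x :* x :+ (u :* u) :* (x :* i)) refl x u (inv x) ⟩
      x * x + (u * u) * (x * inv x)  ≡⟨ cong (λ z → x * x + (u * u) * z) (*-inverseʳ x≢0) ⟩
      x * x + (u * u) * 1#           ≡⟨ cong (λ z → x * x + z) (*-identityʳ (u * u)) ⟩
      x * x + u * u                  ∎
      where open ≡-Reasoning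

    legendre-φ : ∀ x → χ (legendre (u * u) x) ≡ (χ x ℤ.* χ x) ℤ.* χ (φ x − c)
    legendre-φ x with zero-or-nonzero x
    ... | inj₁ refl rewrite legendre-0 (u * u) | χ-zero {0#} refl = refl
    ... | inj₂ x≢0 = trans (cong χ factor) (trans (χ-* (x * x) (φ x − c)) (cong (ℤ._* χ (φ x − c)) (χ-* x x)))
      where
      open ≡-Reasoning
      factor : legendre (u * u) x ≡ (x * x) * (φ x − c)
      factor = begin
        legendre (u * u) x                        ≡⟨ solve 2 (λ x u → (x :* (x :- con (+ 1))) :* (x :- u :* u)
                                                        := x :* ((x :* x :+ u :* u) :- x :* (con (+ 1) :+ u :* u))) refl x u ⟩
        x * ((x * x + u * u) − x * c)             ≡⟨ cong (λ z → x * (z − x * c)) (sym (x·φx x≢0)) ⟩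
        x * (x * φ x − x * c)                     ≡⟨ solve 3 (λ x y c → x :* (x :* y :- x :* c) := (x :* x) :* (y :- c)) refl x (φ x) c ⟩
        (x * x) * (φ x − c)                       ∎

    D : Carrier → Carrier
    D t = t * t − (two * u) * (two * u)

    Q : Carrier → Carrier → Carrier
    Q x t = x * x − x * t + u * u

    complete-square : ∀ x t → (two * x − t) * (two * x − t) ≡ D t + (two * two) * Q x t
    complete-square x t = solve 3 (λ u x t → (con (+ 2) :* x :- t) :* (con (+ 2) :* x :- t)
      := (t :* t :- (con (+ 2) :* u) :* (con (+ 2) :* u)) :+ (con (+ 2) :* con (+ 2)) :* (x :* x :- x :* t :+ u :* u)) refl u x t

    square≡D⇔Q≡0 : ∀ x t → ((two * x − t) * (two * x − t) ≡ D t → Q x t ≡ 0#) × (Q x t ≡ 0# → (two * x − t) * (two * x − t) ≡ D t)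
    square≡D⇔Q≡0 x t = to , from′
      where
      to : (two * x − t) * (two * x − t) ≡ D t → Q x t ≡ 0#
      to e with no-zero-divisors {two * two} {Q x t}
                  (+-cancelˡ (D t) _ _ (trans (sym (complete-square x t)) (trans e (sym (+-identityʳ (D t))))))
      ... | inj₁ four≡0 = ⊥-elim (four≢0 four≡0)
      ... | inj₂ Q≡0 = Q≡0
      from′ : Q x t ≡ 0# → (two * x − t) * (two * x − t) ≡ D t
      from′ Q≡0 = trans (complete-square x t) (trans (cong (λ z → D t + (two * two) * z) Q≡0)
                    (trans (cong (λ z → D t + z) (zeroʳ (two * two))) (+-identityʳ (D t))))

    φ≡t⇔Q≡0 : ∀ {x} t → x ≢ 0# → (φ x ≡ t → Q x t ≡ 0#) × (Q x t ≡ 0# → φ x ≡ t)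
    φ≡t⇔Q≡0 {x} t x≢0 = to , from′
      where
      to : φ x ≡ t → Q x t ≡ 0#
      to refl = begin
        x * x − x * φ x + u * u             ≡⟨ cong (λ z → x * x − z + u * u) (x·φx x≢0) ⟩
        x * x − (x * x + u * u) + u * u     ≡⟨ solve 2 (λ a b → a :- (a :+ b) :+ b := con (+ 0)) refl (x * x) (u * u) ⟩
        0#                                  ∎
        where open ≡-Reasoning
      from′ : Q x t ≡ 0# → φ x ≡ t
      from′ Q≡0 = *-cancelˡ x≢0 (begin
        x * φ x                            ≡⟨ x·φx x≢0 ⟩
        x * x + u * u                      ≡⟨ solve 3 (λ x t w → x :* x :+ w := x :* t :+ (x :* x :- x :* t :+ w)) refl x t (u * u) ⟩
        x * t + Q x t                      ≡⟨ cong (λ z → x * t + z) Q≡0 ⟩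
        x * t + 0#                         ≡⟨ +-identityʳ (x * t) ⟩
        x * t                              ∎)
        where open ≡-Reasoning

    -- the fibre of φ over t, weighted by χ(x)² (i.e. excluding x = 0)
    fibre-term : ∀ t x → (χ x ℤ.* χ x) ℤ.* δ (φ x ≟ t) ≡ δ (((two * x − t) * (two * x − t)) ≟ D t)
    fibre-term t x with zero-or-nonzero x
    ... | inj₁ refl rewrite χ-zero {0#} refl = sym (δ-no (((two * 0# − t) * (two * 0# − t)) ≟ D t) Q≢0)
      where
      Q≢0 : (two * 0# − t) * (two * 0# − t) ≢ D t
      Q≢0 e = *-nonzero u≢0 u≢0 (trans (solve 2 (λ u t → u :* u := con (+ 0) :* con (+ 0) :- con (+ 0) :* t :+ u :* u) refl u t)
                                       (proj₁ (square≡D⇔Q≡0 0# t) e))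
    ... | inj₂ x≢0 = trans (cong (ℤ._* δ (φ x ≟ t)) (trans (sym (χ-* x x)) (χ-of-square x≢0)))
                     (trans (ℤP.*-identityˡ _) (δ-⇔ (φ x ≟ t) _
                       (λ e → proj₂ (square≡D⇔Q≡0 x t) (proj₁ (φ≡t⇔Q≡0 t x≢0) e))
                       (λ e → proj₂ (φ≡t⇔Q≡0 t x≢0) (proj₁ (square≡D⇔Q≡0 x t) e))))

    fibre-size : ∀ t → ∑ (λ x → (χ x ℤ.* χ x) ℤ.* δ (φ x ≟ t)) ≡ 1ℤ ℤ.+ χ (D t)
    fibre-size t = trans (∑-cong (fibre-term t))
                   (trans (∑-affine (- t) two≢0 (λ y → δ ((y * y) ≟ D t))) (roots≡1+χ (D t)))

    change-of-variable : ∀ X → (- (s * s) * X + c − c) * D (- (s * s) * X + c)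
                             ≡ - ((s * s * s) * (s * s * s)) * legendre (v * v) X
    change-of-variable X = begin
      (- (s * s) * X + c − c) * D (- (s * s) * X + c)
        ≡⟨ solve 2 (λ u X → ((:- ((con (+ 1) :+ u) :* (con (+ 1) :+ u))) :* X :+ (con (+ 1) :+ u :* u) :- (con (+ 1) :+ u :* u))
                            :* (((:- ((con (+ 1) :+ u) :* (con (+ 1) :+ u))) :* X :+ (con (+ 1) :+ u :* u))
                                 :* ((:- ((con (+ 1) :+ u) :* (con (+ 1) :+ u))) :* X :+ (con (+ 1) :+ u :* u))
                                :- (con (+ 2) :* u) :* (con (+ 2) :* u))
                          := (:- ((con (+ 1) :+ u) :* (con (+ 1) :+ u)) :* X)
                            :* (((con (+ 1) :- u) :* (con (+ 1) :- u) :- ((con (+ 1) :+ u) :* (con (+ 1) :+ u)) :* X)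
                                :* ((con (+ 1) :+ u) :* (con (+ 1) :+ u) :- ((con (+ 1) :+ u) :* (con (+ 1) :+ u)) :* X))) refl u X ⟩
      (- (s * s) * X) * (((1# − u) * (1# − u) − (s * s) * X) * (s * s − (s * s) * X))
        ≡⟨ cong (λ w → (- (s * s) * X) * ((w * w − (s * s) * X) * (s * s − (s * s) * X))) (sym s·v) ⟩
      (- (s * s) * X) * (((s * v) * (s * v) − (s * s) * X) * (s * s − (s * s) * X))
        ≡⟨ solve 3 (λ s v X → ((:- (s :* s)) :* X) :* (((s :* v) :* (s :* v) :- (s :* s) :* X) :* (s :* s :- (s :* s) :* X))
                            := (:- ((s :* s :* s) :* (s :* s :* s))) :* ((X :* (X :- con (+ 1))) :* (X :- v :* v))) refl s v X ⟩
      - ((s * s * s) * (s * s * s)) * legendre (v * v) X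
        ∎
      where
      open ≡-Reasoning
      s·v : s * v ≡ 1# − u
      s·v = trans (*-comm s v) (trans (*-assoc (1# − u) (inv s) s) (trans (cong ((1# − u) *_) (*-inverseˡ s≢0)) (*-identityʳ (1# − u))))

    χ-s⁶ : χ (- ((s * s * s) * (s * s * s))) ≡ 1ℤ
    χ-s⁶ = trans (χ-neg _) (χ-of-square (*-nonzero (*-nonzero s≢0 s≢0) s≢0))

    landen : T (u * u) ≡ T (v * v)
    landen = begin
      ∑ (λ x → χ (legendre (u * u) x))                             ≡⟨ ∑-cong legendre-φ ⟩
      ∑ (λ x → (χ x ℤ.* χ x) ℤ.* χ (φ x − c))                      ≡⟨ ∑-fibres (λ x → χ x ℤ.* χ x) φ (λ t → χ (t − c)) ⟩
      ∑ (λ t → χ (t − c) ℤ.* ∑ (λ x → (χ x ℤ.* χ x) ℤ.* δ (φ x ≟ t))) ≡⟨ ∑-cong (λ t → cong (χ (t − c) ℤ.*_) (fibre-size t)) ⟩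
      ∑ (λ t → χ (t − c) ℤ.* (1ℤ ℤ.+ χ (D t)))                     ≡⟨ ∑-cong (λ t → ℤP.*-distribˡ-+ (χ (t − c)) 1ℤ (χ (D t))) ⟩
      ∑ (λ t → χ (t − c) ℤ.* 1ℤ ℤ.+ χ (t − c) ℤ.* χ (D t))         ≡⟨ ∑-+ (λ t → χ (t − c) ℤ.* 1ℤ) (λ t → χ (t − c) ℤ.* χ (D t)) ⟩
      ∑ (λ t → χ (t − c) ℤ.* 1ℤ) ℤ.+ ∑ (λ t → χ (t − c) ℤ.* χ (D t)) ≡⟨ cong₂ ℤ._+_ shifted-∑χ (∑-cong (λ t → sym (χ-* (t − c) (D t)))) ⟩
      0ℤ ℤ.+ ∑ (λ t → χ ((t − c) * D t))                           ≡⟨ ℤP.+-identityˡ _ ⟩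
      ∑ (λ t → χ ((t − c) * D t))                                  ≡⟨ sym (∑-affine c (neg-nonzero (*-nonzero s≢0 s≢0)) (λ t → χ ((t − c) * D t))) ⟩
      ∑ (λ X → χ ((- (s * s) * X + c − c) * D (- (s * s) * X + c))) ≡⟨ ∑-cong (λ X → cong χ (change-of-variable X)) ⟩
      ∑ (λ X → χ (- ((s * s * s) * (s * s * s)) * legendre (v * v) X)) ≡⟨ ∑-cong (λ X → trans (χ-* _ (legendre (v * v) X))
                                                                          (trans (cong (ℤ._* χ (legendre (v * v) X)) χ-s⁶) (ℤP.*-identityˡ _))) ⟩
      ∑ (λ X → χ (legendre (v * v) X))                             ∎
      where
      open ≡-Reasoning
      shifted-∑χ : ∑ (λ t → χ (t − c) ℤ.* 1ℤ) ≡ 0ℤ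
      shifted-∑χ = trans (∑-cong (λ t → trans (ℤP.*-identityʳ _) (cong (λ z → χ (z − c)) (sym (*-identityˡ t)))))
                         (trans (∑-affine (- c) 1≢0 χ) ∑χ≡0)

-- The points with y ≠ 0 come in pairs (x, ±y) over the x with χ(f x) = 1,
-- and the Klein four-group generated by  x ↦ e/x  and  x ↦ (x − e)/(x − 1)
-- acts freely on those x; the three points with y = 0 contribute 3.
module PointCountMod8 {q : ℕ} (F : FiniteField q) (q≡1 : q % 4 ≡ 1) where
  open FiniteField F
  open LegendreSums F q≡1 public

  module NonsquarePair (e : Carrier) (e≢0 : e ≢ 0#) (e≢1 : e ≢ 1#)
                       (e-nonsquare : ¬ Square e) (1-e-nonsquare : ¬ Square (1# − e)) where
    f : Carrier → Carrier
    f = legendre e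

    P : Carrier → Bool
    P x = does (χ (f x) ℤ.≟ 1ℤ)

    χ-P : ∀ x → P x ≡ true → χ (f x) ≡ 1ℤ
    χ-P x = does-true (χ (f x) ℤ.≟ 1ℤ)

    P-intro : ∀ x → χ (f x) ≡ 1ℤ → P x ≡ true
    P-intro x = dec-true (χ (f x) ℤ.≟ 1ℤ)

    f≢0 : ∀ x → P x ≡ true → f x ≢ 0#
    f≢0 x Px fx≡0 = 0≢1ℤ (trans (sym (χ-zero fx≡0)) (χ-P x Px))

    x≢0 : ∀ x → P x ≡ true → x ≢ 0#
    x≢0 x Px refl = f≢0 0# Px (legendre-0 e)

    x-1≢0 : ∀ x → P x ≡ true → x − 1# ≢ 0#
    x-1≢0 x Px z = f≢0 x Px (trans (cong (λ w → x * w * (x − e)) z) (trans (cong (_* (x − e)) (zeroʳ x)) (zeroˡ _)))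

    x-e≢0 : ∀ x → P x ≡ true → x − e ≢ 0#
    x-e≢0 x Px z = f≢0 x Px (trans (cong (λ w → x * (x − 1#) * w) z) (zeroʳ _))

    1-e≢0 : 1# − e ≢ 0#
    1-e≢0 z = e≢1 (sym (difference-zero z))

    α β : Carrier → Carrier
    α x = e * inv x
    β x = (x − e) * inv (x − 1#)

    -- f (α x) and f (β x) are f x times a nonzero square, so α and β preserve P
    α-closed : ∀ x → P x ≡ true → P (α x) ≡ true
    α-closed x Px = P-intro (α x) (trans (cong χ f-α) (trans (χ-scale (f x) w≢0) (χ-P x Px)))
      where
      open ≡-Reasoning
      i : Carrier
      i = inv x
      w≢0 : e * i * i ≢ 0#
      w≢0 = *-nonzero (*-nonzero e≢0 (inv-nonzero (x≢0 x Px))) (inv-nonzero (x≢0 x Px))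
      f-α : f (α x) ≡ (e * i * i) * (e * i * i) * f x
      f-α = begin
        (e * i) * (e * i − 1#) * (e * i − e)
          ≡⟨ cong₂ (λ a b → (e * i) * a * b) (fraction-shift e 1# (x≢0 x Px)) (fraction-shift e e (x≢0 x Px)) ⟩
        (e * i) * ((e − 1# * x) * i) * ((e − e * x) * i)
          ≡⟨ cong₂ (λ a b → (e * i) * (a * i) * (b * i))
               (solve 2 (λ e x → e :- con (+ 1) :* x := :- (x :- e)) refl e x)
               (solve 2 (λ e x → e :- e :* x := :- (e :* (x :- con (+ 1)))) refl e x) ⟩
        (e * i) * (- (x − e) * i) * (- (e * (x − 1#)) * i)
          ≡⟨ *-by-one _ (*-inverseʳ (x≢0 x Px)) ⟩
        ((e * i) * (- (x − e) * i) * (- (e * (x − 1#)) * i)) * (x * i)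
          ≡⟨ solve 5 (λ e i x a b → ((e :* i) :* ((:- a) :* i) :* ((:- (e :* b)) :* i)) :* (x :* i)
                                  := (e :* i :* i) :* (e :* i :* i) :* ((x :* b) :* a)) refl e i x (x − e) (x − 1#) ⟩
        (e * i * i) * (e * i * i) * f x ∎

    β-closed : ∀ x → P x ≡ true → P (β x) ≡ true
    β-closed x Px = P-intro (β x) (trans (cong χ f-β) (trans (χ-scale (f x) w≢0) (χ-P x Px)))
      where
      open ≡-Reasoning
      j : Carrier
      j = inv (x − 1#)
      w≢0 : (1# − e) * j * j ≢ 0#
      w≢0 = *-nonzero (*-nonzero 1-e≢0 (inv-nonzero (x-1≢0 x Px))) (inv-nonzero (x-1≢0 x Px))
      f-β : f (β x) ≡ ((1# − e) * j * j) * ((1# − e) * j * j) * f x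
      f-β = begin
        ((x − e) * j) * ((x − e) * j − 1#) * ((x − e) * j − e)
          ≡⟨ cong₂ (λ a b → ((x − e) * j) * a * b) (fraction-shift (x − e) 1# (x-1≢0 x Px)) (fraction-shift (x − e) e (x-1≢0 x Px)) ⟩
        ((x − e) * j) * (((x − e) − 1# * (x − 1#)) * j) * (((x − e) − e * (x − 1#)) * j)
          ≡⟨ cong₂ (λ a b → ((x − e) * j) * (a * j) * (b * j))
               (solve 2 (λ e x → (x :- e) :- con (+ 1) :* (x :- con (+ 1)) := con (+ 1) :- e) refl e x)
               (solve 2 (λ e x → (x :- e) :- e :* (x :- con (+ 1)) := x :* (con (+ 1) :- e)) refl e x) ⟩
        ((x − e) * j) * ((1# − e) * j) * ((x * (1# − e)) * j)
          ≡⟨ *-by-one _ (*-inverseʳ (x-1≢0 x Px)) ⟩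
        (((x − e) * j) * ((1# − e) * j) * ((x * (1# − e)) * j)) * ((x − 1#) * j)
          ≡⟨ solve 5 (λ a c x b j → ((a :* j) :* (c :* j) :* ((x :* c) :* j)) :* (b :* j)
                                  := (c :* j :* j) :* (c :* j :* j) :* ((x :* b) :* a)) refl (x − e) (1# − e) x (x − 1#) j ⟩
        ((1# − e) * j * j) * ((1# − e) * j * j) * f x ∎

    α-involutive : ∀ x → P x ≡ true → α (α x) ≡ x
    α-involutive x _ = begin
      e * inv (e * inv x)   ≡⟨ cong (e *_) (trans (inv-* e (inv x)) (cong (inv e *_) (inv-involutive x))) ⟩
      e * (inv e * x)       ≡⟨ sym (*-assoc e (inv e) x) ⟩
      (e * inv e) * x       ≡⟨ cong (_* x) (*-inverseʳ e≢0) ⟩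
      1# * x                ≡⟨ *-identityˡ x ⟩
      x                     ∎
      where open ≡-Reasoning

    β-involutive : ∀ x → P x ≡ true → β (β x) ≡ x
    β-involutive x Px = begin
      (β x − e) * inv (β x − 1#)                                 ≡⟨ cong₂ (λ a b → a * inv b) (fraction-shift (x − e) e (x-1≢0 x Px))
                                                                     (fraction-shift (x − e) 1# (x-1≢0 x Px)) ⟩
      (((x − e) − e * (x − 1#)) * j) * inv w                     ≡⟨ cong (λ a → (a * j) * inv w)
                                                                     (solve 2 (λ e x → (x :- e) :- e :* (x :- con (+ 1)) := x :* ((x :- e) :- con (+ 1) :* (x :- con (+ 1)))) refl e x) ⟩
      ((x * ((x − e) − 1# * (x − 1#))) * j) * inv w               ≡⟨ cong (_* inv w) (*-assoc x _ j) ⟩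
      (x * w) * inv w                                            ≡⟨ *-inv-cancel x w≢0 ⟩
      x                                                          ∎
      where
      open ≡-Reasoning
      j : Carrier
      j = inv (x − 1#)
      w : Carrier
      w = ((x − e) − 1# * (x − 1#)) * j
      w≢0 : w ≢ 0#
      w≢0 = *-nonzero (λ z → 1-e≢0 (trans (solve 2 (λ e x → con (+ 1) :- e := (x :- e) :- con (+ 1) :* (x :- con (+ 1))) refl e x) z))
                      (inv-nonzero (x-1≢0 x Px))

    αβ-form : ∀ x → α (β x) ≡ (e * (x − 1#)) * inv (x − e)
    αβ-form x = begin
      e * inv ((x − e) * inv (x − 1#))       ≡⟨ cong (e *_) (trans (inv-* (x − e) _) (cong (inv (x − e) *_) (inv-involutive _))) ⟩
      e * (inv (x − e) * (x − 1#))           ≡⟨ solve 3 (λ e h y → e :* (h :* y) := (e :* y) :* h) refl e (inv (x − e)) (x − 1#) ⟩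
      (e * (x − 1#)) * inv (x − e)           ∎
      where open ≡-Reasoning

    αβ-commute : ∀ x → P x ≡ true → α (β x) ≡ β (α x)
    αβ-commute x Px = sym (begin
      (e * i − e) * inv (e * i − 1#)                         ≡⟨ cong₂ (λ a b → a * inv b) (fraction-shift e e (x≢0 x Px)) (fraction-shift e 1# (x≢0 x Px)) ⟩
      ((e − e * x) * i) * inv ((e − 1# * x) * i)             ≡⟨ cong (((e − e * x) * i) *_) (trans (inv-* (e − 1# * x) i) (cong (inv (e − 1# * x) *_) (inv-involutive x))) ⟩
      ((e − e * x) * i) * (inv (e − 1# * x) * x)             ≡⟨ solve 4 (λ a i b x → (a :* i) :* (b :* x) := (a :* b) :* (x :* i)) refl (e − e * x) i (inv (e − 1# * x)) x ⟩
      ((e − e * x) * inv (e − 1# * x)) * (x * i)             ≡⟨ sym (*-by-one _ (*-inverseʳ (x≢0 x Px))) ⟩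
      (e − e * x) * inv (e − 1# * x)                         ≡⟨ cong₂ (λ a b → a * inv b) (solve 2 (λ e x → e :- e :* x := :- (e :* (x :- con (+ 1)))) refl e x)
                                                               (solve 2 (λ e x → e :- con (+ 1) :* x := :- (x :- e)) refl e x) ⟩
      (- (e * (x − 1#))) * inv (- (x − e))                   ≡⟨ cong (λ z → (- (e * (x − 1#))) * z) (inv-neg (x − e)) ⟩
      (- (e * (x − 1#))) * (- inv (x − e))                   ≡⟨ solve 2 (λ a b → (:- a) :* (:- b) := a :* b) refl (e * (x − 1#)) (inv (x − e)) ⟩
      (e * (x − 1#)) * inv (x − e)                           ≡⟨ sym (αβ-form x) ⟩
      α (β x)                                                ∎)
      where
      open ≡-Reasoning
      i : Carrier
      i = inv x

    -- a fixed point of α would make e a square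
    α-free : ∀ x → P x ≡ true → α x ≢ x
    α-free x Px αx≡x = e-nonsquare (x , (begin
      e              ≡⟨ sym (*-inv-cancel e (x≢0 x Px)) ⟩
      (e * x) * i    ≡⟨ solve 3 (λ e x i → (e :* x) :* i := (e :* i) :* x) refl e x i ⟩
      (e * i) * x    ≡⟨ cong (_* x) αx≡x ⟩
      x * x          ∎))
      where
      open ≡-Reasoning
      i : Carrier
      i = inv x

    -- a fixed point of β would make 1 − e a square
    β-free : ∀ x → P x ≡ true → β x ≢ x
    β-free x Px βx≡x = 1-e-nonsquare (x − 1# , (begin
      1# − e                       ≡⟨ solve 2 (λ e x → con (+ 1) :- e := ((x :- e) :- x) :+ con (+ 1)) refl e x ⟩
      ((x − e) − x) + 1#           ≡⟨ cong (λ z → (z − x) + 1#) x-e≡x[x-1] ⟩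
      ((x * (x − 1#)) − x) + 1#    ≡⟨ solve 1 (λ x → ((x :* (x :- con (+ 1))) :- x) :+ con (+ 1) := (x :- con (+ 1)) :* (x :- con (+ 1))) refl x ⟩
      (x − 1#) * (x − 1#)          ∎))
      where
      open ≡-Reasoning
      x-e≡x[x-1] : x − e ≡ x * (x − 1#)
      x-e≡x[x-1] = trans (sym (*-inv-cancel (x − e) (x-1≢0 x Px)))
                   (trans (*-assoc (x − e) (x − 1#) _) (trans (cong ((x − e) *_) (*-comm (x − 1#) _))
                   (trans (sym (*-assoc (x − e) _ (x − 1#))) (cong (_* (x − 1#)) βx≡x))))

    -- a fixed point of αβ would give f x = e (x − 1)², so χ (f x) = χ e = −1
    αβ-free : ∀ x → P x ≡ true → α (β x) ≢ x
    αβ-free x Px αβx≡x = -1≢1ℤ (trans (sym χ-fx) (χ-P x Px))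
      where
      open ≡-Reasoning
      e[x-1]≡x[x-e] : e * (x − 1#) ≡ x * (x − e)
      e[x-1]≡x[x-e] = begin
        e * (x − 1#)                                    ≡⟨ sym (*-inv-cancel (e * (x − 1#)) (x-e≢0 x Px)) ⟩
        (e * (x − 1#) * (x − e)) * inv (x − e)          ≡⟨ solve 3 (λ a b h → (a :* b) :* h := (a :* h) :* b) refl (e * (x − 1#)) (x − e) (inv (x − e)) ⟩
        ((e * (x − 1#)) * inv (x − e)) * (x − e)        ≡⟨ cong (_* (x − e)) (trans (sym (αβ-form x)) αβx≡x) ⟩
        x * (x − e)                                     ∎
      χ-fx : χ (f x) ≡ -1ℤ
      χ-fx = begin
        χ (x * (x − 1#) * (x − e))              ≡⟨ cong χ (solve 3 (λ x y z → (x :* y) :* z := y :* (x :* z)) refl x (x − 1#) (x − e)) ⟩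
        χ ((x − 1#) * (x * (x − e)))            ≡⟨ cong (λ z → χ ((x − 1#) * z)) (sym e[x-1]≡x[x-e]) ⟩
        χ ((x − 1#) * (e * (x − 1#)))           ≡⟨ cong χ (solve 2 (λ e y → y :* (e :* y) := (y :* y) :* e) refl e (x − 1#)) ⟩
        χ (((x − 1#) * (x − 1#)) * e)           ≡⟨ χ-scale e (x-1≢0 x Px) ⟩
        χ e                                     ≡⟨ χ-nonsquare e-nonsquare ⟩
        -1ℤ                                     ∎

    open KleinFour F P α β α-closed β-closed α-involutive β-involutive αβ-commute α-free β-free αβ-free

    tally3 : ∀ {u v w u′ v′ w′ : ℤ} → u ≡ u′ → v ≡ v′ → w ≡ w′ → u ℤ.+ (v ℤ.+ w) ≡ u′ ℤ.+ (v′ ℤ.+ w′)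
    tally3 refl refl refl = refl

    -- 1 + χ z counts the square roots of z:  one if z = 0, two if χ z = 1
    roots-split : ∀ z → 1ℤ ℤ.+ χ z ≡ δ (z ≟ 0#) ℤ.+ + 2 ℤ.* [ does (χ z ℤ.≟ 1ℤ) ]ᵇ
    roots-split z with zero-or-nonzero z
    ... | inj₁ refl = trans (cong (λ t → 1ℤ ℤ.+ t) (χ-zero {0#} refl))
                        (sym (cong₂ ℤ._+_ (δ-yes (0# ≟ 0#) refl) (cong (λ b → + 2 ℤ.* [ b ]ᵇ) (dec-false (χ 0# ℤ.≟ 1ℤ) (λ e → 0≢1ℤ (trans (sym (χ-zero {0#} refl)) e))))))
    ... | inj₂ z≢0 with square? z
    ...   | yes s = trans (cong (λ t → 1ℤ ℤ.+ t) (χ-square z≢0 s))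
                      (sym (cong₂ ℤ._+_ (δ-no (z ≟ 0#) z≢0) (cong (λ b → + 2 ℤ.* [ b ]ᵇ) (dec-true (χ z ℤ.≟ 1ℤ) (χ-square z≢0 s)))))
    ...   | no ns = trans (cong (λ t → 1ℤ ℤ.+ t) (χ-nonsquare ns))
                      (sym (cong₂ ℤ._+_ (δ-no (z ≟ 0#) z≢0) (cong (λ b → + 2 ℤ.* [ b ]ᵇ) (dec-false (χ z ℤ.≟ 1ℤ) (λ e → -1≢1ℤ (trans (sym (χ-nonsquare ns)) e))))))

    roots-of-f : ∀ x → δ (f x ≟ 0#) ≡ δ (0# ≟ x) ℤ.+ (δ (1# ≟ x) ℤ.+ δ (e ≟ x))
    roots-of-f x with x ≟ 0# | x ≟ 1# | x ≟ e
    ... | yes refl | _ | _ = trans (δ-yes (f 0# ≟ 0#) (legendre-0 e))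
                               (sym (tally3 (δ-yes (0# ≟ 0#) refl) (δ-no (1# ≟ 0#) 1≢0) (δ-no (e ≟ 0#) e≢0)))
    ... | no x≢0 | yes refl | _ = trans (δ-yes (f 1# ≟ 0#) f1≡0)
                                    (sym (tally3 (δ-no (0# ≟ 1#) (λ z → 1≢0 (sym z))) (δ-yes (1# ≟ 1#) refl) (δ-no (e ≟ 1#) e≢1)))
      where
      f1≡0 : f 1# ≡ 0#
      f1≡0 = trans (cong (λ w → 1# * w * (1# − e)) (-‿inverseʳ 1#)) (trans (cong (_* (1# − e)) (zeroʳ 1#)) (zeroˡ _))
    ... | no x≢0 | no x≢1 | yes refl = trans (δ-yes (f x ≟ 0#) fe≡0)
                                         (sym (tally3 (δ-no (0# ≟ x) (λ z → x≢0 (sym z))) (δ-no (1# ≟ x) (λ z → x≢1 (sym z))) (δ-yes (x ≟ x) refl)))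
      where
      fe≡0 : f x ≡ 0#
      fe≡0 = trans (cong (λ w → x * (x − 1#) * w) (-‿inverseʳ x)) (zeroʳ _)
    ... | no x≢0 | no x≢1 | no x≢e = trans (δ-no (f x ≟ 0#) (*-nonzero (*-nonzero x≢0 (difference-nonzero x≢1)) (difference-nonzero x≢e)))
                                       (sym (tally3 (δ-no (0# ≟ x) (λ z → x≢0 (sym z))) (δ-no (1# ≟ x) (λ z → x≢1 (sym z))) (δ-no (e ≟ x) (λ z → x≢e (sym z)))))

    point-count : ∃ λ k → + pointCount F e ≡ + 4 ℤ.+ + 8 ℤ.* k
    point-count = count SecondPairing.Rep , (begin
      + suc (affineCount F e)                               ≡⟨ ℤP.pos-+ 1 (affineCount F e) ⟩
      + 1 ℤ.+ + affineCount F e                             ≡⟨ cong (λ z → + 1 ℤ.+ z) (affine-points e) ⟩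
      + 1 ℤ.+ ∑ (λ x → roots (f x))                         ≡⟨ cong (λ z → + 1 ℤ.+ z) (∑-cong (λ x → trans (roots≡1+χ (f x)) (roots-split (f x)))) ⟩
      + 1 ℤ.+ ∑ (λ x → δ (f x ≟ 0#) ℤ.+ + 2 ℤ.* [ P x ]ᵇ)   ≡⟨ cong (λ z → + 1 ℤ.+ z) (∑-+ (λ x → δ (f x ≟ 0#)) (λ x → + 2 ℤ.* [ P x ]ᵇ)) ⟩
      + 1 ℤ.+ (∑ (λ x → δ (f x ≟ 0#)) ℤ.+ ∑ (λ x → + 2 ℤ.* [ P x ]ᵇ))
                                                            ≡⟨ cong (λ z → + 1 ℤ.+ z) (cong₂ ℤ._+_ three-roots (trans (∑-*ˡ (+ 2) (λ x → [ P x ]ᵇ)) (cong (+ 2 ℤ.*_) count-quadruples))) ⟩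
      + 1 ℤ.+ (+ 3 ℤ.+ + 2 ℤ.* (+ 4 ℤ.* count SecondPairing.Rep)) ≡⟨ arithmetic (count SecondPairing.Rep) ⟩
      + 4 ℤ.+ + 8 ℤ.* count SecondPairing.Rep                ∎)
      where
      open ≡-Reasoning
      three-roots : ∑ (λ x → δ (f x ≟ 0#)) ≡ + 3
      three-roots = begin
        ∑ (λ x → δ (f x ≟ 0#))                                         ≡⟨ ∑-cong roots-of-f ⟩
        ∑ (λ x → δ (0# ≟ x) ℤ.+ (δ (1# ≟ x) ℤ.+ δ (e ≟ x)))             ≡⟨ ∑-+ (λ x → δ (0# ≟ x)) (λ x → δ (1# ≟ x) ℤ.+ δ (e ≟ x)) ⟩
        ∑ (λ x → δ (0# ≟ x)) ℤ.+ ∑ (λ x → δ (1# ≟ x) ℤ.+ δ (e ≟ x))     ≡⟨ cong₂ ℤ._+_ (∑-δ-one 0#) (∑-+ (λ x → δ (1# ≟ x)) (λ x → δ (e ≟ x))) ⟩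
        1ℤ ℤ.+ (∑ (λ x → δ (1# ≟ x)) ℤ.+ ∑ (λ x → δ (e ≟ x)))          ≡⟨ cong (λ z → 1ℤ ℤ.+ z) (cong₂ ℤ._+_ (∑-δ-one 1#) (∑-δ-one e)) ⟩
        + 3                                                            ∎
      arithmetic : ∀ k → + 1 ℤ.+ (+ 3 ℤ.+ + 2 ℤ.* (+ 4 ℤ.* k)) ≡ + 4 ℤ.+ + 8 ℤ.* k
      arithmetic = solve-∀

  one-minus-square : ∀ e → e ≢ 0# → e ≢ 1# → ¬ Square e →
    (+ 8) ℤD.∣ ((+ q ℤ.+ + 1) ℤ.- traceA F e) → Square (1# − e)
  one-minus-square e e≢0 e≢1 e-nonsquare 8∣#L with square? (1# − e)
  ... | yes s = s
  ... | no 1-e-nonsquare = ⊥-elim (incompatible (multiple-of 8 (+ q ℤ.+ + 1) (pointCount F e) 8∣#L)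
                                                (NonsquarePair.point-count e e≢0 e≢1 e-nonsquare 1-e-nonsquare))
    where
    incompatible : (∃ λ m → + pointCount F e ≡ + 8 ℤ.* m) → (∃ λ k → + pointCount F e ≡ + 4 ℤ.+ + 8 ℤ.* k) → ⊥
    incompatible (m , #L≡8m) (k , #L≡4+8k) =
      residues-differ 8 0 4 m k (ℕ.s≤s ℕ.z≤n) (ℕ.s≤s (ℕ.s≤s (ℕ.s≤s (ℕ.s≤s (ℕ.s≤s ℕ.z≤n)))))
        (trans (ℤP.+-identityˡ (+ 8 ℤ.* m)) (trans (sym #L≡8m) #L≡4+8k))

-- With the Cayley transform  V u = (1 − u)/(1 + u)  put  E u = 1 − (V u)² = 4u/(1 + u)².
module LandenBijection {q : ℕ} (F : FiniteField q) (q≡1 : q % 4 ≡ 1) where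
  open FiniteField F
  open PointCountMod8 F q≡1

  V : Carrier → Carrier
  V u = (1# − u) * inv (1# + u)

  E : Carrier → Carrier
  E u = 1# − V u * V u

  V-neg : ∀ x → V (- x) ≡ inv (V x)
  V-neg x = begin
    (1# − - x) * inv (1# + - x)                ≡⟨ cong₂ (λ a b → a * inv b) (solve 1 (λ x → con (+ 1) :- (:- x) := con (+ 1) :+ x) refl x) refl ⟩
    (1# + x) * inv (1# − x)                    ≡⟨ *-comm (1# + x) (inv (1# − x)) ⟩
    inv (1# − x) * (1# + x)                    ≡⟨ cong (inv (1# − x) *_) (sym (inv-involutive (1# + x))) ⟩
    inv (1# − x) * inv (inv (1# + x))          ≡⟨ sym (inv-* (1# − x) (inv (1# + x))) ⟩
    inv (V x)                                  ∎
    where open ≡-Reasoning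

  V-0 : V 0# ≡ 1#
  V-0 = trans (cong₂ (λ a b → a * inv b) (solve 0 (con (+ 1) :- con (+ 0) := con (+ 1)) refl) (+-identityʳ 1#))
              (trans (cong (1# *_) inv-1) (*-identityˡ 1#))

  V-1 : V 1# ≡ 0#
  V-1 = trans (cong (_* inv (1# + 1#)) (-‿inverseʳ 1#)) (zeroˡ _)

  module Cayley (u : Carrier) (1+u≢0 : 1# + u ≢ 0#) where
    private
      j : Carrier
      j = inv (1# + u)

    1-V : 1# − V u ≡ (two * u) * j
    1-V = begin
      1# − (1# − u) * j                   ≡⟨ cong (_− (1# − u) * j) (sym (*-inverseʳ 1+u≢0)) ⟩
      (1# + u) * j − (1# − u) * j          ≡⟨ solve 2 (λ u j → (con (+ 1) :+ u) :* j :- (con (+ 1) :- u) :* j := (con (+ 2) :* u) :* j) refl u j ⟩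
      (two * u) * j                       ∎
      where open ≡-Reasoning

    1+V : 1# + V u ≡ two * j
    1+V = begin
      1# + (1# − u) * j                   ≡⟨ cong (_+ (1# − u) * j) (sym (*-inverseʳ 1+u≢0)) ⟩
      (1# + u) * j + (1# − u) * j          ≡⟨ solve 2 (λ u j → (con (+ 1) :+ u) :* j :+ (con (+ 1) :- u) :* j := con (+ 2) :* j) refl u j ⟩
      two * j                             ∎
      where open ≡-Reasoning

    2j≢0 : two * j ≢ 0#
    2j≢0 = *-nonzero two≢0 (inv-nonzero 1+u≢0)

    1+V≢0 : 1# + V u ≢ 0#
    1+V≢0 z = 2j≢0 (trans (sym 1+V) z)

    V-involutive : V (V u) ≡ u
    V-involutive = begin
      (1# − V u) * inv (1# + V u)        ≡⟨ cong₂ (λ a b → a * inv b) 1-V 1+V ⟩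
      ((two * u) * j) * inv (two * j)    ≡⟨ cong (_* inv (two * j)) (solve 3 (λ t u j → (t :* u) :* j := u :* (t :* j)) refl two u j) ⟩
      (u * (two * j)) * inv (two * j)    ≡⟨ *-inv-cancel u 2j≢0 ⟩
      u                                  ∎
      where open ≡-Reasoning

    E-factor : E u ≡ ((two * j) * (two * j)) * u
    E-factor = begin
      1# − V u * V u                     ≡⟨ solve 1 (λ v → con (+ 1) :- v :* v := (con (+ 1) :- v) :* (con (+ 1) :+ v)) refl (V u) ⟩
      (1# − V u) * (1# + V u)             ≡⟨ cong₂ _*_ 1-V 1+V ⟩
      ((two * u) * j) * (two * j)         ≡⟨ solve 3 (λ t u j → ((t :* u) :* j) :* (t :* j) := ((t :* j) :* (t :* j)) :* u) refl two u j ⟩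
      ((two * j) * (two * j)) * u         ∎
      where open ≡-Reasoning

    E-nonzero : u ≢ 0# → E u ≢ 0#
    E-nonzero u≢0 z = *-nonzero (*-nonzero 2j≢0 2j≢0) u≢0 (trans (sym E-factor) z)

    E-not-one : u ≢ 1# → E u ≢ 1#
    E-not-one u≢1 E≡1 = u≢1 (trans (sym V-involutive) (trans (cong V V≡0) V-0))
      where
      V≡0 : V u ≡ 0#
      V≡0 = square-zero (trans (solve 2 (λ a b → b := a :- (a :- b)) refl 1# (V u * V u))
              (trans (cong (1# −_) E≡1) (-‿inverseʳ 1#)))

    E-square : Square u → Square (E u)
    E-square s = subst Square (sym E-factor) (square-product (square (two * j)) s)

    E-nonsquare : ¬ Square u → ¬ Square (E u)
    E-nonsquare ns s = nonsquare-product (*-nonzero 2j≢0 2j≢0) (square (two * j)) ns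
                         (subst Square (trans E-factor (*-comm _ u)) s)

    -- Landen and reflection: the curves for u² and for E u have the same trace
    trace-E : u ≢ 0# → traceA F (u * u) ≡ traceA F (E u)
    trace-E u≢0 = begin
      traceA F (u * u)        ≡⟨ traceA≡-T (u * u) ⟩
      ℤ.- T (u * u)           ≡⟨ cong ℤ.-_ (Landen.landen u u≢0 1+u≢0) ⟩
      ℤ.- T (V u * V u)       ≡⟨ cong ℤ.-_ (sym (T-reflect (V u * V u))) ⟩
      ℤ.- T (E u)             ≡⟨ sym (traceA≡-T (E u)) ⟩
      traceA F (E u)          ∎
      where open ≡-Reasoning

  E-fibres : ∀ {u u′} → 1# + u ≢ 0# → 1# + u′ ≢ 0# → E u ≡ E u′ → u ≡ u′ ⊎ u′ ≡ inv u
  E-fibres {u} {u′} 1+u≢0 1+u′≢0 E≡E with square-roots (-‿injective (+-cancelˡ 1# _ _ E≡E))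
  ... | inj₁ V≡V = inj₁ (begin
    u             ≡⟨ sym (Cayley.V-involutive u 1+u≢0) ⟩
    V (V u)       ≡⟨ cong V V≡V ⟩
    V (V u′)      ≡⟨ Cayley.V-involutive u′ 1+u′≢0 ⟩
    u′            ∎)
    where open ≡-Reasoning
  ... | inj₂ V≡-V = inj₂ (begin
    u′                ≡⟨ sym (Cayley.V-involutive u′ 1+u′≢0) ⟩
    V (V u′)          ≡⟨ cong V (trans (sym (-‿involutive (V u′))) (cong -_ (sym V≡-V))) ⟩
    V (- V u)         ≡⟨ V-neg (V u) ⟩
    inv (V (V u))     ≡⟨ cong inv (Cayley.V-involutive u 1+u≢0) ⟩
    inv u             ∎)
    where open ≡-Reasoning

  -- some square root of d, found by search (0 if d is not a square)
  sqrt : Carrier → Carrier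
  sqrt d with FinP.any? (λ i → d ≟ (enum i * enum i))
  ... | yes (i , _) = enum i
  ... | no _ = 0#

  sqrt-correct : ∀ {d} → Square d → sqrt d * sqrt d ≡ d
  sqrt-correct {d} (y , d≡yy) with FinP.any? (λ i → d ≟ (enum i * enum i))
  ... | yes (i , d≡ii) = sym d≡ii
  ... | no none = ⊥-elim (none (from y , trans d≡yy (cong (λ z → z * z) (sym (enum-from y)))))

  -- A coherent choice of square roots: of each pair {d, 1/d} the member of
  -- smaller index gets sqrt, the other one  −1/(its partner's root),
  -- so that  root (1/d) = −1/root d  whenever 1/d ≠ d.
  choose-root : Bool → Carrier → Carrier
  choose-root true d = sqrt d
  choose-root false d = - inv (sqrt (inv d))

  root : Carrier → Carrier
  root d = choose-root (index d <ᵇ index (inv d)) d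

  root-correct : ∀ {d} → Square d → root d * root d ≡ d
  root-correct {d} (y , d≡yy) with index d <ᵇ index (inv d)
  ... | true = sqrt-correct (y , d≡yy)
  ... | false = begin
      (- inv w) * (- inv w)   ≡⟨ neg-square (inv w) ⟩
      inv w * inv w           ≡⟨ sym (inv-* w w) ⟩
      inv (w * w)             ≡⟨ cong inv (sqrt-correct (inv y , trans (cong inv d≡yy) (inv-* y y))) ⟩
      inv (inv d)             ≡⟨ inv-involutive d ⟩
      d                       ∎
    where
    open ≡-Reasoning
    w : Carrier
    w = sqrt (inv d)

  root-inv : ∀ d → inv d ≢ d → root (inv d) ≡ - inv (root d)
  root-inv d inv-d≢d = trans unfold-inv (by-cases (index d <ᵇ index (inv d)) (index (inv d) <ᵇ index d) refl refl)
    where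
    unfold-inv : root (inv d) ≡ choose-root (index (inv d) <ᵇ index d) (inv d)
    unfold-inv = cong (λ z → choose-root (index (inv d) <ᵇ index z) (inv d)) (inv-involutive d)
    one-smaller : [ index d <ᵇ index (inv d) ]ᵇ ℤ.+ [ index (inv d) <ᵇ index d ]ᵇ ≡ 1ℤ
    one-smaller = exactly-one-smaller (index d) (index (inv d)) (λ e → inv-d≢d (sym (index-injective e)))
    by-cases : ∀ b₁ b₂ → (index d <ᵇ index (inv d)) ≡ b₁ → (index (inv d) <ᵇ index d) ≡ b₂ →
      choose-root b₂ (inv d) ≡ - inv (root d)
    by-cases true true e₁ e₂ with () ← trans (sym (cong₂ (λ a b → [ a ]ᵇ ℤ.+ [ b ]ᵇ) e₁ e₂)) one-smaller
    by-cases false false e₁ e₂ with () ← trans (sym (cong₂ (λ a b → [ a ]ᵇ ℤ.+ [ b ]ᵇ) e₁ e₂)) one-smaller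
    by-cases true false e₁ _ rewrite e₁ = cong (λ z → - inv (sqrt z)) (inv-involutive d)
    by-cases false true e₁ _ rewrite e₁ = sym (begin
      - inv (- inv (sqrt (inv d)))     ≡⟨ cong -_ (inv-neg _) ⟩
      - - inv (inv (sqrt (inv d)))     ≡⟨ -‿involutive _ ⟩
      inv (inv (sqrt (inv d)))         ≡⟨ inv-involutive _ ⟩
      sqrt (inv d)                     ∎)
      where open ≡-Reasoning

  landen-map : Carrier → Carrier
  landen-map d = E (root d)

  module _ (A : ℤ) where
    module Root (d : Carrier) (d∈ : InN2n4 F A d) where
      d≢0 : d ≢ 0#
      d≢0 = proj₁ d∈
      d≢1 : d ≢ 1#
      d≢1 = proj₁ (proj₂ d∈)
      trace-d : traceA F d ≡ A
      trace-d = proj₁ (proj₂ (proj₂ d∈))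
      d-square : Square d
      d-square = proj₁ (proj₂ (proj₂ (proj₂ d∈)))
      d-not-fourth : ¬ IsFourthPower F d
      d-not-fourth = proj₂ (proj₂ (proj₂ (proj₂ d∈)))

      u : Carrier
      u = root d

      u² : u * u ≡ d
      u² = root-correct d-square

      u≢0 : u ≢ 0#
      u≢0 u≡0 = d≢0 (trans (sym u²) (trans (cong (λ w → w * w) u≡0) (zeroˡ 0#)))

      u≢1 : u ≢ 1#
      u≢1 u≡1 = d≢1 (trans (sym u²) (trans (cong (λ w → w * w) u≡1) (*-identityˡ 1#)))

      1+u≢0 : 1# + u ≢ 0#
      1+u≢0 z = d≢1 (trans (sym u²) (trans (cong (λ w → w * w) u≡-1) (trans (neg-square 1#) (*-identityˡ 1#))))
        where
        u≡-1 : u ≡ - 1#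
        u≡-1 = trans (solve 1 (λ u → u := (con (+ 1) :+ u) :- con (+ 1)) refl u) (trans (cong (_− 1#) z) (+-identityˡ (- 1#)))

      u-nonsquare : ¬ Square u
      u-nonsquare (y , u≡yy) = d-not-fourth (y , trans (sym u²) (cong (λ w → w * w) u≡yy))

    maps-into : ∀ d → InN2n4 F A d → InNn2 F A (landen-map d)
    maps-into d d∈ = Cayley.E-nonzero u 1+u≢0 u≢0 , Cayley.E-not-one u 1+u≢0 u≢1 ,
                     trans (sym (Cayley.trace-E u 1+u≢0 u≢0)) (trans (cong (traceA F) u²) trace-d) ,
                     Cayley.E-nonsquare u 1+u≢0 u-nonsquare
      where open Root d d∈

    -- equal images force equal roots or reciprocal roots; the coherent
    -- choice of roots excludes the latter unless d′ = d
    injective : ∀ d d′ → InN2n4 F A d → InN2n4 F A d′ → landen-map d ≡ landen-map d′ → d ≡ d′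
    injective d d′ d∈ d′∈ E≡E = from-roots (E-fibres (Root.1+u≢0 d d∈) (Root.1+u≢0 d′ d′∈) E≡E) (d ≟ d′)
      where
      open ≡-Reasoning
      from-roots : root d ≡ root d′ ⊎ root d′ ≡ inv (root d) → Dec (d ≡ d′) → d ≡ d′
      from-roots _ (yes d≡d′) = d≡d′
      from-roots (inj₁ u≡u′) (no _) = trans (sym (Root.u² d d∈)) (trans (cong (λ w → w * w) u≡u′) (Root.u² d′ d′∈))
      from-roots (inj₂ u′≡1/u) (no d≢d′) = ⊥-elim (neg-free (inv-nonzero (Root.u≢0 d d∈)) (begin
        - inv (root d)     ≡⟨ sym (root-inv d (λ e → d≢d′ (trans (sym e) (sym d′≡1/d)))) ⟩
        root (inv d)       ≡⟨ cong root (sym d′≡1/d) ⟩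
        root d′            ≡⟨ u′≡1/u ⟩
        inv (root d)       ∎))
        where
        d′≡1/d : d′ ≡ inv d
        d′≡1/d = begin
          d′                             ≡⟨ sym (Root.u² d′ d′∈) ⟩
          root d′ * root d′              ≡⟨ cong (λ w → w * w) u′≡1/u ⟩
          inv (root d) * inv (root d)    ≡⟨ sym (inv-* (root d) (root d)) ⟩
          inv (root d * root d)          ≡⟨ cong inv (Root.u² d d∈) ⟩
          inv d                          ∎

    module _ (8∣q+1-A : (+ 8) ℤD.∣ ((+ q ℤ.+ + 1) ℤ.- A)) (e : Carrier) (e∈ : InNn2 F A e) where
      e≢0 : e ≢ 0#
      e≢0 = proj₁ e∈
      e≢1 : e ≢ 1#
      e≢1 = proj₁ (proj₂ e∈)
      trace-e : traceA F e ≡ A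
      trace-e = proj₁ (proj₂ (proj₂ e∈))
      e-nonsquare : ¬ Square e
      e-nonsquare = proj₂ (proj₂ (proj₂ e∈))

      -- a square root w of 1 − e yields the preimage candidate d = (V w)²
      module Preimage (w : Carrier) (1-e≡ww : 1# − e ≡ w * w) where
        ww≢1 : w * w ≢ 1#
        ww≢1 ww≡1 = e≢0 (-‿injective (trans (+-cancelˡ 1# _ _ (trans 1-e≡ww (trans ww≡1 (sym (+-identityʳ 1#))))) (sym -0≡0)))

        w≢0 : w ≢ 0#
        w≢0 w≡0 = e≢1 (sym (difference-zero (trans 1-e≡ww (trans (cong (λ v → v * v) w≡0) (zeroˡ 0#)))))

        1+w≢0 : 1# + w ≢ 0#
        1+w≢0 z = ww≢1 (trans (cong (λ v → v * v) w≡-1) (trans (neg-square 1#) (*-identityˡ 1#)))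
          where
          w≡-1 : w ≡ - 1#
          w≡-1 = trans (solve 1 (λ w → w := (con (+ 1) :+ w) :- con (+ 1)) refl w) (trans (cong (_− 1#) z) (+-identityˡ (- 1#)))

        U : Carrier
        U = V w

        VU≡w : V U ≡ w
        VU≡w = Cayley.V-involutive w 1+w≢0

        EU≡e : E U ≡ e
        EU≡e = begin
          1# − V U * V U     ≡⟨ cong (λ v → 1# − v * v) VU≡w ⟩
          1# − w * w         ≡⟨ cong (1# −_) (sym 1-e≡ww) ⟩
          1# − (1# − e)      ≡⟨ solve 1 (λ e → con (+ 1) :- (con (+ 1) :- e) := e) refl e ⟩
          e                  ∎
          where open ≡-Reasoning

        1+U≢0 : 1# + U ≢ 0#
        1+U≢0 = Cayley.1+V≢0 w 1+w≢0

        U≢0 : U ≢ 0#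
        U≢0 U≡0 = ww≢1 (trans (cong (λ v → v * v) (trans (sym VU≡w) (trans (cong V U≡0) V-0))) (*-identityˡ 1#))

        d : Carrier
        d = U * U

        d∈ : InN2n4 F A d
        d∈ = *-nonzero U≢0 U≢0 , UU≢1 ,
             trans (Cayley.trace-E U 1+U≢0 U≢0) (trans (cong (traceA F) EU≡e) trace-e) , square U , not-fourth
          where
          UU≢1 : U * U ≢ 1#
          UU≢1 UU≡1 = [ (λ U≡1 → w≢0 (trans (sym VU≡w) (trans (cong V U≡1) V-1)))
                      , (λ U≡-1 → 1+U≢0 (trans (cong (λ z → 1# + z) U≡-1) (-‿inverseʳ 1#))) ]′ (square-one UU≡1)
          -- if U² = y⁴ then U = ±y² is a square (−1 being a square), hence so is e = E U
          not-fourth : ¬ IsFourthPower F d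
          not-fourth (y , d≡y⁴) = e-nonsquare (subst Square EU≡e (Cayley.E-square U 1+U≢0 U-square))
            where
            i : Carrier
            i = proj₁ -1-square
            U-square : Square U
            U-square = [ (λ U≡yy → y , U≡yy)
                       , (λ U≡-yy → i * y , trans U≡-yy (trans (sym (-1*x≈-x (y * y))) (trans (cong (_* (y * y)) (proj₂ -1-square))
                                  (solve 2 (λ i y → (i :* i) :* (y :* y) := (i :* y) :* (i :* y)) refl i y)))) ]′
                       (square-roots {U} {y * y} d≡y⁴)

      surjective : ∃ λ d → InN2n4 F A d × landen-map d ≡ e
      surjective = by-cases (square-roots (root-correct (square P₊.U))) (inv P₊.d ≟ P₊.d)
        where
        w : Carrier
        w = proj₁ (one-minus-square e e≢0 e≢1 e-nonsquare (subst (λ a → (+ 8) ℤD.∣ ((+ q ℤ.+ + 1) ℤ.- a)) (sym trace-e) 8∣q+1-A))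
        1-e≡ww : 1# − e ≡ w * w
        1-e≡ww = proj₂ (one-minus-square e e≢0 e≢1 e-nonsquare (subst (λ a → (+ 8) ℤD.∣ ((+ q ℤ.+ + 1) ℤ.- a)) (sym trace-e) 8∣q+1-A))
        module P₊ = Preimage w 1-e≡ww
        module P₋ = Preimage (- w) (trans 1-e≡ww (sym (neg-square w)))
        U₋≡1/U₊ : P₋.U ≡ inv P₊.U
        U₋≡1/U₊ = V-neg w
        by-cases : root P₊.d ≡ P₊.U ⊎ root P₊.d ≡ - P₊.U → Dec (inv P₊.d ≡ P₊.d) → ∃ λ d → InN2n4 F A d × landen-map d ≡ e
        by-cases (inj₁ root≡U) _ = P₊.d , P₊.d∈ , trans (cong E root≡U) P₊.EU≡e
        by-cases (inj₂ root≡-U) (no 1/d≢d) = P₋.d , P₋.d∈ , trans (cong E root₋) P₋.EU≡e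
          where
          open ≡-Reasoning
          root₋ : root P₋.d ≡ P₋.U
          root₋ = begin
            root (P₋.U * P₋.U)                 ≡⟨ cong (λ z → root (z * z)) U₋≡1/U₊ ⟩
            root (inv P₊.U * inv P₊.U)         ≡⟨ cong root (sym (inv-* P₊.U P₊.U)) ⟩
            root (inv P₊.d)                    ≡⟨ root-inv P₊.d 1/d≢d ⟩
            - inv (root P₊.d)                  ≡⟨ cong (λ z → - inv z) root≡-U ⟩
            - inv (- P₊.U)                     ≡⟨ cong -_ (inv-neg P₊.U) ⟩
            - - inv P₊.U                       ≡⟨ -‿involutive _ ⟩
            inv P₊.U                           ≡⟨ sym U₋≡1/U₊ ⟩
            P₋.U                               ∎
        -- if d = 1/d then d = −1, so U² = −1 and −U = 1/U = U₋
        by-cases (inj₂ root≡-U) (yes 1/d≡d) = P₊.d , P₊.d∈ , trans (cong E (trans root≡-U -U≡U₋)) P₋.EU≡e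
          where
          UU≡-1 : P₊.U * P₊.U ≡ - 1#
          UU≡-1 = [ (λ d≡1 → ⊥-elim (proj₁ (proj₂ P₊.d∈) d≡1)) , (λ d≡-1 → d≡-1) ]′
                  (square-one (trans (cong (P₊.d *_) (sym 1/d≡d)) (*-inverseʳ (proj₁ P₊.d∈))))
          -U≡U₋ : - P₊.U ≡ P₋.U
          -U≡U₋ = trans (inv-unique (trans (sym (-‿distribʳ-* P₊.U P₊.U)) (trans (cong -_ UU≡-1) (-‿involutive 1#)))) (sym U₋≡1/U₊)

open import Data.Nat using (ℕ; _%_)
open import Data.Integer using (ℤ; +_; _+_; _-_)
open import Data.Integer.Divisibility using (_∣_)

theorem7p6 : (q : ℕ) (F : FiniteField q) → q % 4 ≡ 1 →
    (A : ℤ) → (+ 8) ∣ ((+ q + + 1) - A) →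
    SubsetBijection F (InN2n4 F A) (InNn2 F A)
theorem7p6 q F q≡1 A 8∣q+1-A =
  landen-map , maps-into A , injective A , surjective A 8∣q+1-A
  where open LandenBijection F q≡1
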